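{- For every $\mathbb{N}$-vector $\mathbf c$, $\eta_0(\overleftarrow{\mathfrak{F}}_{\mathbf c})=F_{\mathrm{flat}(\mathbf c)}(\mathbf x_-)$. Moreover, $\pi_+(\overleftarrow{\mathfrak{F}}_{\mathbf c})=\mathfrak{F}_{\mathbf c}$ if $\mathrm{Supp}(\mathbf c)\subseteq\mathbb{Z}_{>0}$, and $\pi_+(\overleftarrow{\mathfrak{F}}_{\mathbf c})=0$ otherwise.
   Context: Variables $\mathbf x=\{x_i:i\in\mathbb{Z}\}$, $\mathbf x_-=\{x_i:i\le0\}$. An $\mathbb{N}$-vector is a finitely supported sequence $\mathbf c=(c_i)_{i\in\mathbb{Z}}$ of nonnegative integers; $\mathrm{Supp}(\mathbf c)=\{i:c_i>0\}$; $\mathrm{flat}(\mathbf c)$ is the composition obtained by listing the positive entries of $\mathbf c$ in order of increasing index. For $D_1\ge\cdots\ge D_r$ the nonincreasing word containing each $i$ exactly $c_i$ times, $\overleftarrow{\mathfrak{F}}_{\mathbf c}=\sum x_{i_1}\cdots x_{i_r}$ over integers $i_1\ge\cdots\ge i_r$ with $i_k\le D_k$ and $i_k>i_{k+1}$ whenever $D_k>D_{k+1}$; the slide polynomial $\mathfrak{F}_{\mathbf c}$ (for $\mathrm{Supp}(\mathbf c)\subseteq\mathbb{Z}_{>0}$) is the same sum restricted to $i_r>0$. For a composition $\alpha=(\alpha_1,\dots,\alpha_\ell)$ of $r$ with $S=\{\alpha_1,\alpha_1+\alpha_2,\dots,\alpha_1+\cdots+\alpha_{\ell-1}\}$, $F_\alpha(\mathbf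 x_-)=\sum x_{i_1}\cdots x_{i_r}$ over $i_1\le i_2\le\cdots\le i_r\le 0$ with $i_j<i_{j+1}$ for $j\in S$ ($F_\varnothing=1$). $\overleftarrow{QR}$ is the space of back quasisymmetric functions (bounded-degree series in $\mathbf x$ involving no $x_i$ for $i$ beyond some $N$, such that for some $b$ the coefficient of $x_{i_1}^{a_1}\cdots x_{i_k}^{a_k}\mathsf m$, for $\mathsf m$ any monomial in $\{x_i:i>b\}$, is the same for all $i_1<\cdots<i_k\le b$); $\overleftarrow{\mathfrak{F}}_{\mathbf c}\in\overleftarrow{QR}$. Every $f\in\overleftarrow{QR}$ is uniquely a finite sum $\sum g_{\mathbf e}\mathbf x^{\mathbf e}$ with $g_{\mathbf e}$ quasisymmetric in $\mathbf x_-$ and distinct monomials $\mathbf x^{\mathbf e}$ in $\mathbb{Q}[\mathbf x]$; $\eta_0(f)$ is the coefficient of the monomial $1$. $\pi_+$ sets $x_i=0$ for all $i\le 0$. -}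

module Defs where

open import Data.Bool using (Bool; true; false; _∧_; if_then_else_)
open import Data.Nat as ℕ using (ℕ; zero; suc)
import Data.Nat.Properties as ℕP
import Data.Integer.Properties as ℤP
open import Relation.Binary.Definitions using (tri<; tri≈; tri>)
open import Data.Integer as ℤ using (ℤ; +_; _-_; ∣_∣)
open import Data.Rational as ℚ using (ℚ; 0ℚ; 1ℚ)
open import Data.List using (List; []; _∷_; length; reverse; concat; concatMap; replicate; zipWith; filter; map; foldr)
open import Data.List.Relation.Unary.Linked using (Linked)
open import Data.List.Relation.Unary.All using (All)
open import Data.List.Relation.Unary.Any using (Any)
open import Data.List.Relation.Unary.AllPairs using (AllPairs)
open import Data.Maybe using (Maybe; just; nothing)
open import Data.Product using (Σ; _×_; _,_; proj₁; proj₂; ∃)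
open import Relation.Binary.PropositionalEquality using (_≡_; _≢_)
open import Relation.Nullary.Decidable using (⌊_⌋)

record NVec : Set where
  field
    c     : ℤ → ℕ
    bound : ℕ
    fin   : ∀ i → bound ℕ.< ∣ i ∣ → c i ≡ 0
open NVec public

downFrom : ℤ → ℕ → List ℤ
downFrom t zero    = []
downFrom t (suc k) = t ∷ downFrom (t - + 1) k

-- all integers N, N-1, ..., -N (contains the support of c)
range : NVec → List ℤ
range v = downFrom (+ bound v) (suc (bound v ℕ.+ bound v))

-- the nonincreasing word D₁ ≥ ⋯ ≥ D_r containing each i exactly c_i times
word : NVec → List ℤ
word v = concatMap (λ i → replicate (c v i) i) (range v)

flat : NVec → List ℕ
flat v = filter (λ k → 1 ℕ.≤? k) (map (c v) (reverse (range v)))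

SuppPos : NVec → Set
SuppPos v = ∀ i → 0 ℕ.< c v i → + 0 ℤ.< i

-- A monomial x_{i₁}⋯x_{i_r} is represented by its (unique) nonincreasing
-- list of indices [i₁, …, i_r], i₁ ≥ ⋯ ≥ i_r; a series is its coefficient
-- function (only its values on nonincreasing lists matter).

Mono : List ℤ → Set
Mono m = Linked ℤ._≥_ m

Series : Set
Series = List ℤ → ℚ

_≈_ : Series → Series → Set
f ≈ g = ∀ m → Mono m → f m ≡ g m

zeroS : Series
zeroS _ = 0ℚ

indicator : Bool → ℚ
indicator true  = 1ℚ
indicator false = 0ℚ

-- The sequences i₁ ≥ ⋯ ≥ i_r are nonincreasing, so
-- the sequence contributing to a monomial is its index list itself; the
-- coefficient of monomial m is 1 if m satisfies the conditions, else 0.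

fcheck : List ℤ → List ℤ → Bool
fcheck [] [] = true
fcheck [] (_ ∷ _) = false
fcheck (_ ∷ _) [] = false
fcheck (d ∷ []) (i ∷ []) = ⌊ i ℤ.≤? d ⌋
fcheck (d ∷ []) (i ∷ _ ∷ _) = false
fcheck (d ∷ _ ∷ _) (i ∷ []) = false
fcheck (d ∷ d' ∷ ds) (i ∷ i' ∷ is) =
  ⌊ i ℤ.≤? d ⌋ ∧ ⌊ i' ℤ.≤? i ⌋ ∧ (if ⌊ d' ℤ.<? d ⌋ then ⌊ i' ℤ.<? i ⌋ else true)
  ∧ fcheck (d' ∷ ds) (i' ∷ is)

Fback : NVec → Series
Fback v m = indicator (fcheck (word v) m)

allPos : List ℤ → Bool
allPos [] = true
allPos (i ∷ is) = ⌊ + 0 ℤ.<? i ⌋ ∧ allPos is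

Fslide : NVec → Series
Fslide v m = if allPos m then Fback v m else 0ℚ

π₊ : Series → Series
π₊ f m = if allPos m then f m else 0ℚ

-- labels (α₁,…,α_ℓ) = 1^{α₁} 2^{α₂} ⋯ ℓ^{α_ℓ}; position j is in S iff
-- label_j < label_{j+1}
labelsFrom : ℕ → List ℕ → List ℕ
labelsFrom k [] = []
labelsFrom k (a ∷ α) = replicate a k ++' labelsFrom (suc k) α
  where
  _++'_ : List ℕ → List ℕ → List ℕ
  [] ++' ys = ys
  (x ∷ xs) ++' ys = x ∷ (xs ++' ys)

qcheck : List ℕ → List ℤ → Bool
qcheck [] [] = true
qcheck [] (_ ∷ _) = false
qcheck (_ ∷ _) [] = false
qcheck (l ∷ []) (i ∷ []) = ⌊ i ℤ.≤? + 0 ⌋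
qcheck (l ∷ []) (i ∷ _ ∷ _) = false
qcheck (l ∷ _ ∷ _) (i ∷ []) = false
qcheck (l ∷ l' ∷ ls) (i ∷ i' ∷ is) =
  ⌊ i ℤ.≤? i' ⌋ ∧ (if ⌊ l ℕ.<? l' ⌋ then ⌊ i ℤ.<? i' ⌋ else true)
  ∧ qcheck (l' ∷ ls) (i' ∷ is)

-- F_α(x₋); the monomial m (nonincreasing) read increasingly is reverse m
QF : List ℕ → Series
QF α m = indicator (qcheck (labelsFrom 1 α) (reverse m))

-- the monomial x_{i₁}^{a₁} ⋯ x_{i_k}^{a_k} as a nonincreasing list
-- (for i₁ < ⋯ < i_k)
monoOf : List ℤ → List ℕ → Series → ℚ
monoOf is a g = g (reverse (concat (zipWith (λ i k → replicate k i) is a)))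

record QSymMinus (g : Series) : Set where
  field
    boundedDeg : ∃ λ D → ∀ m → Mono m → D ℕ.< length m → g m ≡ 0ℚ
    onlyMinus  : ∀ m → Mono m → Any (λ i → + 0 ℤ.< i) m → g m ≡ 0ℚ
    quasisym   : ∀ (a : List ℕ) (is js : List ℤ) → All (λ k → 0 ℕ.< k) a →
                 Linked ℤ._<_ is → Linked ℤ._<_ js →
                 All (λ i → i ℤ.≤ + 0) is → All (λ i → i ℤ.≤ + 0) js →
                 length is ≡ length a → length js ≡ length a →
                 monoOf is a g ≡ monoOf js a g

-- Decompositions f = Σ g_e x^e  (finite, distinct monomials x^e ∈ ℚ[x],
-- g_e quasisymmetric in x₋)

-- multiset difference of nonincreasing lists: m / e if x^e divides x^m
divide : List ℤ → List ℤ → Maybe (List ℤ)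
divide m [] = just m
divide [] (_ ∷ _) = nothing
divide (a ∷ m) (b ∷ e) with ℤP.<-cmp a b
... | tri< _ _ _ = nothing
... | tri≈ _ _ _ = divide m e
... | tri> _ _ _ = Data.Maybe.map (a ∷_) (divide m (b ∷ e))
  where import Data.Maybe

-- coefficient of g · x^e
timesMono : Series → List ℤ → Series
timesMono g e m with divide m e
... | just w  = g w
... | nothing = 0ℚ

Decomp : Set
Decomp = List (List ℤ × Series)

ValidDecomp : Decomp → Set
ValidDecomp d = All (λ p → Mono (proj₁ p) × QSymMinus (proj₂ p)) d
              × AllPairs (λ p q → proj₁ p ≢ proj₁ q) d

evalDecomp : Decomp → Series
evalDecomp d m = foldr (λ p acc → timesMono (proj₂ p) (proj₁ p) m ℚ.+ acc) 0ℚ d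

isEmpty : List ℤ → Bool
isEmpty [] = true
isEmpty (_ ∷ _) = false

comp₀ : Decomp → Series
comp₀ d m = foldr (λ p acc → (if isEmpty (proj₁ p) then proj₂ p m else 0ℚ) ℚ.+ acc) 0ℚ d

-- "η₀(f) = g": f admits a decomposition as above, and in every such
-- decomposition the coefficient of the monomial 1 equals g
Eta₀Is : Series → Series → Set
Eta₀Is f g = (Σ Decomp λ d → ValidDecomp d × evalDecomp d ≈ f)
           × (∀ d → ValidDecomp d → evalDecomp d ≈ f → comp₀ d ≈ g)

-- Write ←𝔉_c as the 0/1 series of a pattern: caps D₁ ≥ ⋯ ≥ D_r, each with a
-- flag saying whether the step into it must be strict.  If every cap is ≤ v,
-- this series is the series of the pattern with all caps lowered to v − 1,
-- plus x_v times series of shorter patterns (the monomials whose largest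
-- variable is x_v).  Lowering repeatedly brings all caps to a common value −k;
-- raising a constant cap from −k − 1 to −k again costs only x_v-multiples of
-- shorter patterns, and a pattern with all caps 0 is quasisymmetric in x₋.  By
-- induction on the length, ←𝔉_c = Σ g_e x^e with g_e quasisymmetric in x₋.
--
-- For the uniqueness of the constant term take any such decomposition and a
-- monomial m in x₋ (for monomials involving some x_i with i > 0 both sides
-- vanish).  Shift m far to the left: g_∅ does not change by quasisymmetry, no
-- x^e with e ≠ ∅ divides the shifted monomial, and there the caps of the
-- pattern no longer matter, so the coefficient is that of the pattern with all
-- caps 0 and the flags of the word of c, which is F_flat(c) read backwards.
--
-- The statements about π₊ are immediate: π₊ ←𝔉_c is 𝔉_c by definition, and a
-- monomial in positive variables bounded entrywise by the word of c forces
-- every letter of the word to be positive.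

module Submission where

open import Algebra.Bundles using (CommutativeMonoid)
open import Data.Bool using (Bool; true; false; _∧_; _∨_; if_then_else_)
import Data.Bool.Properties as BP
open import Data.Empty using (⊥-elim)
open import Data.Integer as ℤ using (ℤ; +_; -[1+_]; _-_; ∣_∣)
import Data.Integer.Properties as ℤP
open import Data.Integer.Tactic.RingSolver using (solve-∀)
open import Data.List using (List; []; _∷_; _++_; _∷ʳ_; length; reverse; concat; concatMap; replicate; zipWith; map; filter; foldl)
import Data.List.Properties as LP
open import Data.List.Membership.Propositional using (_∈_)
open import Data.List.Membership.Propositional.Properties using (∈-concatMap⁺)
open import Data.List.Relation.Binary.Pointwise as PW using (Pointwise; []; _∷_)
open import Data.List.Relation.Unary.All as All using (All; []; _∷_)
import Data.List.Relation.Unary.All.Properties as AllP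
import Data.List.Relation.Unary.All.Properties.Core as AllPC
open import Data.List.Relation.Unary.AllPairs using (AllPairs; []; _∷_)
open import Data.List.Relation.Unary.Any as Any using (Any; here; there)
import Data.List.Relation.Unary.Any.Properties as AnyP
open import Data.List.Relation.Unary.Linked as Lk using (Linked; []; [-]; _∷_)
import Data.List.Relation.Unary.Linked.Properties as LinkedP
open import Data.Maybe as M using (Maybe; just; nothing; maybe′; _>>=_; is-just)
open import Data.Nat as ℕ using (ℕ; zero; suc)
open import Data.Nat.ListAction using (sum)
import Data.Nat.Properties as ℕP
open import Data.Product using (Σ; _×_; _,_; proj₁; proj₂)
open import Data.Rational as ℚ using (ℚ; 0ℚ; 1ℚ)
import Data.Rational.Properties as ℚP
open import Data.Sum using (_⊎_; inj₁; inj₂)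
open import Function using (flip; _∘_)
open import Relation.Binary.Definitions using (Tri; tri<; tri≈; tri>)
open import Relation.Binary.PropositionalEquality
open import Relation.Nullary using (¬_; Dec; yes; no)
open import Relation.Nullary.Decidable using (⌊_⌋)

open import Algebra.Properties.CommutativeSemigroup
  (CommutativeMonoid.commutativeSemigroup ℚP.+-0-commutativeMonoid) using (x∙yz≈y∙xz)

open import Defs

∧≡true⇒ˡ : ∀ {a b} → a ∧ b ≡ true → a ≡ true
∧≡true⇒ˡ {true} _ = refl

∧≡true⇒ʳ : ∀ {a b} → a ∧ b ≡ true → b ≡ true
∧≡true⇒ʳ {true} p = p

∧≡true⇒₃ : ∀ a b c → a ∧ b ∧ c ≡ true → (a ≡ true) × (b ≡ true) × (c ≡ true)
∧≡true⇒₃ true true true _ = refl , refl , refl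

isYes⇒ : ∀ {p} {P : Set p} (d : Dec P) → ⌊ d ⌋ ≡ true → P
isYes⇒ (yes x) _ = x
isYes⇒ (no _) ()

isYes-true : ∀ {p} {P : Set p} (d : Dec P) → P → ⌊ d ⌋ ≡ true
isYes-true (yes _) _ = refl
isYes-true (no ¬x) x = ⊥-elim (¬x x)

isYes-false : ∀ {p} {P : Set p} (d : Dec P) → ¬ P → ⌊ d ⌋ ≡ false
isYes-false (yes x) ¬x = ⊥-elim (¬x x)
isYes-false (no _) _ = refl

isYes-⇔ : ∀ {p q} {P : Set p} {Q : Set q} (a : Dec P) (b : Dec Q) → (P → Q) → (Q → P) → ⌊ a ⌋ ≡ ⌊ b ⌋
isYes-⇔ (yes _) (yes _) _ _ = refl
isYes-⇔ (yes x) (no ¬y) f _ = ⊥-elim (¬y (f x))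
isYes-⇔ (no ¬x) (yes y) _ g = ⊥-elim (¬x (g y))
isYes-⇔ (no _) (no _) _ _ = refl

Mono⇒≤head : ∀ {a w} → Mono (a ∷ w) → All (ℤ._≤ a) w
Mono⇒≤head [-] = []
Mono⇒≤head (r ∷ l) = LinkedP.Linked⇒All (λ p q → ℤP.≤-trans q p) r l

Mono⇒≤ : ∀ {a b w} → Mono (a ∷ b ∷ w) → b ℤ.≤ a
Mono⇒≤ (r ∷ _) = r

Mono-tail : ∀ {a w} → Mono (a ∷ w) → Mono w
Mono-tail [-] = []
Mono-tail (_ ∷ l) = l

Mono-∷ : ∀ {a w} → All (ℤ._≤ a) w → Mono w → Mono (a ∷ w)
Mono-∷ [] _ = [-]
Mono-∷ (p ∷ _) l = p ∷ l

-- `<-cmp` behind a definition of its own: `with ℤP.<-cmp a b` would also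
-- abstract the comparison made inside `divide`, after which `divide-<`,
-- `divide-≡` and `divide->` no longer apply to the goal.
compare : (a b : ℤ) → Tri (a ℤ.< b) (a ≡ b) (b ℤ.< a)
compare a b with ℤP.<-cmp a b
... | tri< x y z = tri< x y z
... | tri≈ x y z = tri≈ x y z
... | tri> x y z = tri> x y z

divide-< : ∀ {a b} m e → a ℤ.< b → divide (a ∷ m) (b ∷ e) ≡ nothing
divide-< {a} {b} m e lt with ℤP.<-cmp a b
... | tri< _ _ _ = refl
... | tri≈ _ eq _ = ⊥-elim (ℤP.<-irrefl eq lt)
... | tri> _ _ gt = ⊥-elim (ℤP.<-asym lt gt)

divide-≡ : ∀ a m e → divide (a ∷ m) (a ∷ e) ≡ divide m e
divide-≡ a m e with ℤP.<-cmp a a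
... | tri< lt _ _ = ⊥-elim (ℤP.<-irrefl refl lt)
... | tri≈ _ _ _ = refl
... | tri> _ _ gt = ⊥-elim (ℤP.<-irrefl refl gt)

divide-> : ∀ {a b} m e → b ℤ.< a → divide (a ∷ m) (b ∷ e) ≡ M.map (a ∷_) (divide m (b ∷ e))
divide-> {a} {b} m e gt with ℤP.<-cmp a b
... | tri< lt _ _ = ⊥-elim (ℤP.<-asym lt gt)
... | tri≈ _ eq _ = ⊥-elim (ℤP.<-irrefl (sym eq) gt)
... | tri> _ _ _ = refl

divide-below : ∀ {a b} m e → a ℤ.< b → All (ℤ._≤ a) m → divide m (b ∷ e) ≡ nothing
divide-below [] e lt _ = refl
divide-below (x ∷ m) e lt (px ∷ _) = divide-< m e (ℤP.≤-<-trans px lt)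

divide-All≤ : ∀ {a} m e w → All (ℤ._≤ a) m → divide m e ≡ just w → All (ℤ._≤ a) w
divide-All≤ m [] w al refl = al
divide-All≤ [] (b ∷ e) w al ()
divide-All≤ (x ∷ m) (b ∷ e) w (px ∷ al) eq with ℤP.<-cmp x b
divide-All≤ (x ∷ m) (b ∷ e) w (px ∷ al) () | tri< _ _ _
... | tri≈ _ _ _ = divide-All≤ m e w al eq
... | tri> _ _ _ with divide m (b ∷ e) in eq′
divide-All≤ (x ∷ m) (b ∷ e) w (px ∷ al) refl | tri> _ _ _ | just w′ = px ∷ divide-All≤ m (b ∷ e) w′ al eq′

divide-Mono : ∀ m e w → Mono m → divide m e ≡ just w → Mono w
divide-Mono m [] w mo refl = mo
divide-Mono [] (b ∷ e) w mo ()
divide-Mono (x ∷ m) (b ∷ e) w mo eq with ℤP.<-cmp x b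
divide-Mono (x ∷ m) (b ∷ e) w mo () | tri< _ _ _
... | tri≈ _ _ _ = divide-Mono m e w (Mono-tail mo) eq
... | tri> _ _ _ with divide m (b ∷ e) in eq′
divide-Mono (x ∷ m) (b ∷ e) w mo refl | tri> _ _ _ | just w′ =
  Mono-∷ (divide-All≤ m (b ∷ e) w′ (Mono⇒≤head mo) eq′) (divide-Mono m (b ∷ e) w′ (Mono-tail mo) eq′)

insert : ℤ → List ℤ → List ℤ
insert v [] = v ∷ []
insert v (b ∷ e) with b ℤ.≤? v
... | yes _ = v ∷ b ∷ e
... | no _ = b ∷ insert v e

insert-All≤ : ∀ {a} v e → v ℤ.≤ a → All (ℤ._≤ a) e → All (ℤ._≤ a) (insert v e)
insert-All≤ v [] va [] = va ∷ []
insert-All≤ v (b ∷ e) va (pb ∷ al) with b ℤ.≤? v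
... | yes _ = va ∷ pb ∷ al
... | no _ = pb ∷ insert-All≤ v e va al

insert-Mono : ∀ v e → Mono e → Mono (insert v e)
insert-Mono v [] _ = [-]
insert-Mono v (b ∷ e) mo with b ℤ.≤? v
... | yes le = le ∷ mo
... | no n = Mono-∷ (insert-All≤ v e (ℤP.<⇒≤ (ℤP.≰⇒> n)) (Mono⇒≤head mo)) (insert-Mono v e (Mono-tail mo))

_/_ : List ℤ → List ℤ → Maybe (List ℤ)
m / e = divide m e

map-∷->>=-/ : ∀ {a b} X e → b ℤ.< a → (M.map (a ∷_) X >>= _/ (b ∷ e)) ≡ M.map (a ∷_) (X >>= _/ (b ∷ e))
map-∷->>=-/ nothing e _ = refl
map-∷->>=-/ (just w) e b<a = divide-> w e b<a

map-∷->>=-/-≡ : ∀ a X e → (M.map (a ∷_) X >>= _/ (a ∷ e)) ≡ (X >>= _/ e)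
map-∷->>=-/-≡ a nothing e = refl
map-∷->>=-/-≡ a (just w) e = divide-≡ a w e

map-∷->>=-/-< : ∀ {a b} X e → a ℤ.< b → (M.map (a ∷_) X >>= _/ (b ∷ e)) ≡ nothing
map-∷->>=-/-< nothing e _ = refl
map-∷->>=-/-< (just w) e a<b = divide-< w e a<b

/-∷ : ∀ v b e m → Mono m → b ℤ.≤ v → m / (v ∷ b ∷ e) ≡ (m / (v ∷ []) >>= _/ (b ∷ e))
/-∷ v b e [] _ _ = refl
/-∷ v b e (a ∷ m) mo b≤v with compare a v
... | tri< a<v _ _ = trans (divide-< m (b ∷ e) a<v) (sym (cong (_>>= _/ (b ∷ e)) (divide-< m [] a<v)))
... | tri≈ _ refl _ = trans (divide-≡ a m (b ∷ e)) (sym (cong (_>>= _/ (b ∷ e)) (divide-≡ a m [])))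
... | tri> _ _ v<a = begin
  (a ∷ m) / (v ∷ b ∷ e)                         ≡⟨ divide-> m (b ∷ e) v<a ⟩
  M.map (a ∷_) (m / (v ∷ b ∷ e))                ≡⟨ cong (M.map (a ∷_)) (/-∷ v b e m (Mono-tail mo) b≤v) ⟩
  M.map (a ∷_) (m / (v ∷ []) >>= _/ (b ∷ e))    ≡⟨ map-∷->>=-/ (m / (v ∷ [])) e (ℤP.≤-<-trans b≤v v<a) ⟨
  (M.map (a ∷_) (m / (v ∷ [])) >>= _/ (b ∷ e))  ≡⟨ cong (_>>= _/ (b ∷ e)) (divide-> m [] v<a) ⟨
  ((a ∷ m) / (v ∷ []) >>= _/ (b ∷ e))           ∎
  where open ≡-Reasoning

/-insert : ∀ v e m → Mono m → m / insert v e ≡ (m / (v ∷ []) >>= _/ e)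
/-∷-insert : ∀ v b e m → Mono m → v ℤ.< b → m / (b ∷ insert v e) ≡ (m / (v ∷ []) >>= _/ (b ∷ e))

/-insert v [] m _ with m / (v ∷ [])
... | just _ = refl
... | nothing = refl
/-insert v (b ∷ e) m mo with b ℤ.≤? v
... | yes b≤v = /-∷ v b e m mo b≤v
... | no b≰v = /-∷-insert v b e m mo (ℤP.≰⇒> b≰v)

/-∷-insert v b e [] _ _ = refl
/-∷-insert v b e (a ∷ m) mo v<b with compare a b
... | tri< a<b _ _ = trans (divide-< m (insert v e) a<b) (sym nothing-right)
  where
  nothing-right : ((a ∷ m) / (v ∷ []) >>= _/ (b ∷ e)) ≡ nothing
  nothing-right with (a ∷ m) / (v ∷ []) in eq
  ... | nothing = refl
  ... | just w = divide-below w e a<b (divide-All≤ (a ∷ m) (v ∷ []) w (ℤP.≤-refl ∷ Mono⇒≤head mo) eq)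
... | tri≈ _ refl _ = begin
  (a ∷ m) / (a ∷ insert v e)                    ≡⟨ divide-≡ a m (insert v e) ⟩
  m / insert v e                                ≡⟨ /-insert v e m (Mono-tail mo) ⟩
  (m / (v ∷ []) >>= _/ e)                       ≡⟨ map-∷->>=-/-≡ a (m / (v ∷ [])) e ⟨
  (M.map (a ∷_) (m / (v ∷ [])) >>= _/ (a ∷ e))  ≡⟨ cong (_>>= _/ (a ∷ e)) (divide-> m [] v<b) ⟨
  ((a ∷ m) / (v ∷ []) >>= _/ (a ∷ e))           ∎
  where open ≡-Reasoning
... | tri> _ _ b<a = begin
  (a ∷ m) / (b ∷ insert v e)                    ≡⟨ divide-> m (insert v e) b<a ⟩
  M.map (a ∷_) (m / (b ∷ insert v e))           ≡⟨ cong (M.map (a ∷_)) (/-∷-insert v b e m (Mono-tail mo) v<b) ⟩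
  M.map (a ∷_) (m / (v ∷ []) >>= _/ (b ∷ e))    ≡⟨ map-∷->>=-/ (m / (v ∷ [])) e b<a ⟨
  (M.map (a ∷_) (m / (v ∷ [])) >>= _/ (b ∷ e))  ≡⟨ cong (_>>= _/ (b ∷ e)) (divide-> m [] (ℤP.<-trans v<b b<a)) ⟨
  ((a ∷ m) / (v ∷ []) >>= _/ (b ∷ e))           ∎
  where open ≡-Reasoning

-- The flag of the first entry is never read.
Pattern : Set
Pattern = List (ℤ × Bool)

accepts : Pattern → List ℤ → Bool
accepts [] [] = true
accepts [] (_ ∷ _) = false
accepts (_ ∷ _) [] = false
accepts ((d , _) ∷ []) (i ∷ []) = ⌊ i ℤ.≤? d ⌋
accepts ((d , _) ∷ []) (i ∷ _ ∷ _) = false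
accepts ((d , _) ∷ _ ∷ _) (i ∷ []) = false
accepts ((d , _) ∷ (d' , f) ∷ P) (i ∷ i' ∷ m) =
  ⌊ i ℤ.≤? d ⌋ ∧ ⌊ i' ℤ.≤? i ⌋ ∧ (if f then ⌊ i' ℤ.<? i ⌋ else true) ∧ accepts ((d' , f) ∷ P) (i' ∷ m)

series : Pattern → Series
series P m = indicator (accepts P m)

caps : Pattern → List ℤ
caps = map proj₁

accepts⇒≤caps : ∀ P m → accepts P m ≡ true → Pointwise (λ p i → i ℤ.≤ proj₁ p) P m
accepts⇒≤caps [] [] _ = []
accepts⇒≤caps ((d , _) ∷ []) (i ∷ []) e = isYes⇒ (i ℤ.≤? d) e ∷ []
accepts⇒≤caps ((d , _) ∷ (d' , f) ∷ P) (i ∷ i' ∷ m) e =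
  isYes⇒ (i ℤ.≤? d) (∧≡true⇒ˡ e) ∷ accepts⇒≤caps ((d' , f) ∷ P) (i' ∷ m) rest
  where
  rest : accepts ((d' , f) ∷ P) (i' ∷ m) ≡ true
  rest = ∧≡true⇒ʳ {if f then ⌊ i' ℤ.<? i ⌋ else true} (∧≡true⇒ʳ {⌊ i' ℤ.≤? i ⌋} (∧≡true⇒ʳ {⌊ i ℤ.≤? d ⌋} e))

accepts⇒length : ∀ P m → accepts P m ≡ true → length m ≡ length P
accepts⇒length P m e = sym (PW.Pointwise-length (accepts⇒≤caps P m e))

accepts-length≢ : ∀ P m → length P ≢ length m → accepts P m ≡ false
accepts-length≢ P m P≢m with accepts P m in accepted
... | false = refl
... | true = ⊥-elim (P≢m (sym (accepts⇒length P m accepted)))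

constPattern : ℤ → List Bool → Pattern
constPattern t = map (t ,_)

length-constPattern : ∀ t fs → length (constPattern t fs) ≡ length fs
length-constPattern t fs = LP.length-map (t ,_) fs

wordPattern′ : ℤ → List ℤ → Pattern
wordPattern′ p [] = []
wordPattern′ p (d ∷ ds) = (d , ⌊ d ℤ.<? p ⌋) ∷ wordPattern′ d ds

wordPattern : List ℤ → Pattern
wordPattern [] = []
wordPattern (d ∷ ds) = (d , false) ∷ wordPattern′ d ds

fcheck≡accepts : ∀ D m → fcheck D m ≡ accepts (wordPattern D) m
fcheck≡accepts [] [] = refl
fcheck≡accepts [] (_ ∷ _) = refl
fcheck≡accepts (d ∷ ds) m = fcheck≡accepts′ d ds false m
  where
  fcheck≡accepts′ : ∀ d ds f m → fcheck (d ∷ ds) m ≡ accepts ((d , f) ∷ wordPattern′ d ds) m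
  fcheck≡accepts′ d [] f [] = refl
  fcheck≡accepts′ d [] f (i ∷ []) = refl
  fcheck≡accepts′ d [] f (i ∷ _ ∷ _) = refl
  fcheck≡accepts′ d (d' ∷ ds) f [] = refl
  fcheck≡accepts′ d (d' ∷ ds) f (i ∷ []) = refl
  fcheck≡accepts′ d (d' ∷ ds) f (i ∷ i' ∷ m) =
    cong (λ x → ⌊ i ℤ.≤? d ⌋ ∧ ⌊ i' ℤ.≤? i ⌋ ∧ (if ⌊ d' ℤ.<? d ⌋ then ⌊ i' ℤ.<? i ⌋ else true) ∧ x)
         (fcheck≡accepts′ d' ds _ (i' ∷ m))

caps-wordPattern : ∀ D → caps (wordPattern D) ≡ D
caps-wordPattern [] = refl
caps-wordPattern (d ∷ ds) = cong (d ∷_) (caps-wordPattern′ d ds)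
  where
  caps-wordPattern′ : ∀ p D → caps (wordPattern′ p D) ≡ D
  caps-wordPattern′ p [] = refl
  caps-wordPattern′ p (d ∷ ds) = cong (d ∷_) (caps-wordPattern′ d ds)

∈downFrom : ∀ k t j → j ℕ.≤ k → t - + j ∈ downFrom t (suc k)
∈downFrom k t zero _ = here (ℤP.+-identityʳ t)
∈downFrom (suc k) t (suc j) (ℕ.s≤s j≤k) = there (Any.map (trans (t-[1+x]≡t-1-x t (+ j))) (∈downFrom k (t - + 1) j j≤k))
  where
  t-[1+x]≡t-1-x : ∀ t x → t - (ℤ.1ℤ ℤ.+ x) ≡ (t - ℤ.1ℤ) - x
  t-[1+x]≡t-1-x = solve-∀

∈range : ∀ v i → ∣ i ∣ ℕ.≤ bound v → i ∈ range v
∈range v i ∣i∣≤N = Any.map (trans (sym (N-offset≡ i ∣i∣≤N))) (∈downFrom (N ℕ.+ N) (+ N) (offset i) (offset≤ i ∣i∣≤N))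
  where
  N = bound v
  offset : ℤ → ℕ
  offset (+ n) = N ℕ.∸ n
  offset -[1+ n ] = N ℕ.+ suc n
  offset≤ : ∀ i → ∣ i ∣ ℕ.≤ N → offset i ℕ.≤ N ℕ.+ N
  offset≤ (+ n) _ = ℕP.≤-trans (ℕP.m∸n≤m N n) (ℕP.m≤m+n N N)
  offset≤ -[1+ n ] le = ℕP.+-monoʳ-≤ N le
  N-offset≡ : ∀ i → ∣ i ∣ ℕ.≤ N → + N - + offset i ≡ i
  N-offset≡ (+ n) le = begin
    + N - + (N ℕ.∸ n)            ≡⟨ ℤP.m-n≡m⊖n N (N ℕ.∸ n) ⟩
    N ℤ.⊖ (N ℕ.∸ n)              ≡⟨ ℤP.⊖-≥ (ℕP.m∸n≤m N n) ⟩
    + (N ℕ.∸ (N ℕ.∸ n))          ≡⟨ cong +_ (ℕP.m∸[m∸n]≡n le) ⟩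
    + n                          ∎
    where open ≡-Reasoning
  N-offset≡ -[1+ n ] _ = begin
    + N - + (N ℕ.+ suc n)        ≡⟨ ℤP.m-n≡m⊖n N (N ℕ.+ suc n) ⟩
    N ℤ.⊖ (N ℕ.+ suc n)          ≡⟨ cong (ℤ._⊖ (N ℕ.+ suc n)) (ℕP.+-identityʳ N) ⟨
    (N ℕ.+ 0) ℤ.⊖ (N ℕ.+ suc n)  ≡⟨ ℤP.+-cancelˡ-⊖ N 0 (suc n) ⟩
    -[1+ n ]                     ∎
    where open ≡-Reasoning

∈word : ∀ v i → 0 ℕ.< c v i → i ∈ word v
∈word v i ci>0 = ∈-concatMap⁺ (λ j → replicate (c v j) j) (Any.map (λ { refl → ∈replicate ci>0 }) (∈range v i ∣i∣≤N))
  where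
  ∣i∣≤N : ∣ i ∣ ℕ.≤ bound v
  ∣i∣≤N = ℕP.≮⇒≥ (λ N<∣i∣ → ℕP.<⇒≢ ci>0 (sym (fin v i N<∣i∣)))
  ∈replicate : ∀ {n} → 0 ℕ.< n → i ∈ replicate n i
  ∈replicate {suc n} _ = here refl

allPos⇒All : ∀ m → allPos m ≡ true → All (+ 0 ℤ.<_) m
allPos⇒All [] _ = []
allPos⇒All (i ∷ m) e = isYes⇒ (+ 0 ℤ.<? i) (∧≡true⇒ˡ e) ∷ allPos⇒All m (∧≡true⇒ʳ e)

positive-caps : ∀ {P m} → Pointwise (λ p i → i ℤ.≤ proj₁ p) P m → All (+ 0 ℤ.<_) m → All (+ 0 ℤ.<_) (caps P)
positive-caps [] [] = []
positive-caps (i≤d ∷ r) (0<i ∷ a) = ℤP.<-≤-trans 0<i i≤d ∷ positive-caps r a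

π₊-Fback-SuppPos : ∀ v → SuppPos v → π₊ (Fback v) ≈ Fslide v
π₊-Fback-SuppPos v _ m _ = refl

π₊-Fback-¬SuppPos : ∀ v → ¬ SuppPos v → π₊ (Fback v) ≈ zeroS
π₊-Fback-¬SuppPos v ¬supp m _ with allPos m in m>0
... | false = refl
... | true with fcheck (word v) m in accepted
...   | false = refl
...   | true = ⊥-elim (¬supp (λ i ci>0 → All.lookup word>0 (∈word v i ci>0)))
  where
  word>0 : All (+ 0 ℤ.<_) (word v)
  word>0 = subst (All _) (caps-wordPattern (word v))
    (positive-caps (accepts⇒≤caps (wordPattern (word v)) m (trans (sym (fcheck≡accepts (word v) m)) accepted))
                   (allPos⇒All m m>0))


infixl 6 _⊕_
_⊕_ : Series → Series → Series
(f ⊕ g) m = f m ℚ.+ g m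

negate : Series → Series
negate f m = ℚ.- f m

mulVar : ℤ → Series → Series
mulVar v f m = maybe′ f 0ℚ (divide m (v ∷ []))

timesMono≡maybe : ∀ g e m → timesMono g e m ≡ maybe′ g 0ℚ (divide m e)
timesMono≡maybe g e m with divide m e
... | just _ = refl
... | nothing = refl

0+0 : 0ℚ ℚ.+ 0ℚ ≡ 0ℚ
0+0 = ℚP.+-identityʳ 0ℚ

x≡x+0 : ∀ x → x ≡ x ℚ.+ 0ℚ
x≡x+0 x = sym (ℚP.+-identityʳ x)

x≡0+x : ∀ x → x ≡ 0ℚ ℚ.+ x
x≡0+x x = sym (ℚP.+-identityˡ x)

QSymMinus-⊕ : ∀ {f g} → QSymMinus f → QSymMinus g → QSymMinus (f ⊕ g)
QSymMinus-⊕ qf qg = record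
  { boundedDeg = Df ℕ.⊔ Dg , λ m mo D<m →
      trans (cong₂ ℚ._+_ (f-deg m mo (ℕP.≤-<-trans (ℕP.m≤m⊔n Df Dg) D<m))
                         (g-deg m mo (ℕP.≤-<-trans (ℕP.m≤n⊔m Df Dg) D<m))) 0+0
  ; onlyMinus = λ m mo m>0 → trans (cong₂ ℚ._+_ (F.onlyMinus m mo m>0) (G.onlyMinus m mo m>0)) 0+0
  ; quasisym = λ a is js a>0 is< js< is≤0 js≤0 is≡a js≡a →
      cong₂ ℚ._+_ (F.quasisym a is js a>0 is< js< is≤0 js≤0 is≡a js≡a) (G.quasisym a is js a>0 is< js< is≤0 js≤0 is≡a js≡a)
  }
  where
  module F = QSymMinus qf
  module G = QSymMinus qg
  Df = proj₁ F.boundedDeg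
  f-deg = proj₂ F.boundedDeg
  Dg = proj₁ G.boundedDeg
  g-deg = proj₂ G.boundedDeg

QSymMinus-negate : ∀ {f} → QSymMinus f → QSymMinus (negate f)
QSymMinus-negate qf = record
  { boundedDeg = proj₁ F.boundedDeg , λ m mo D<m → cong ℚ.-_ (proj₂ F.boundedDeg m mo D<m)
  ; onlyMinus = λ m mo m>0 → cong ℚ.-_ (F.onlyMinus m mo m>0)
  ; quasisym = λ a is js a>0 is< js< is≤0 js≤0 is≡a js≡a → cong ℚ.-_ (F.quasisym a is js a>0 is< js< is≤0 js≤0 is≡a js≡a)
  }
  where module F = QSymMinus qf

ValidTerm : List ℤ × Series → Set
ValidTerm p = Mono (proj₁ p) × QSymMinus (proj₂ p)

-- As in `Eta₀Is`, except that keys may repeat; `merge` removes repetitions.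
Decomposable : Series → Set
Decomposable f = Σ Decomp λ d → All ValidTerm d × evalDecomp d ≈ f

Decomposable-resp : ∀ {f g} → (∀ m → Mono m → f m ≡ g m) → Decomposable f → Decomposable g
Decomposable-resp f≗g (d , v , e) = d , v , λ m mo → trans (e m mo) (f≗g m mo)

Decomposable-qsym : ∀ {g} → QSymMinus g → Decomposable g
Decomposable-qsym {g} q = ([] , g) ∷ [] , ([] , q) ∷ [] , λ m _ → ℚP.+-identityʳ (g m)

Decomposable-zero : Decomposable zeroS
Decomposable-zero = [] , [] , λ m mo → refl

eval-++ : ∀ d1 d2 m → evalDecomp (d1 ++ d2) m ≡ evalDecomp d1 m ℚ.+ evalDecomp d2 m
eval-++ [] d2 m = sym (ℚP.+-identityˡ _)
eval-++ ((e , g) ∷ d1) d2 m =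
  trans (cong (timesMono g e m ℚ.+_) (eval-++ d1 d2 m)) (sym (ℚP.+-assoc (timesMono g e m) (evalDecomp d1 m) (evalDecomp d2 m)))

Decomposable-⊕ : ∀ {f g} → Decomposable f → Decomposable g → Decomposable (f ⊕ g)
Decomposable-⊕ (d1 , v1 , e1) (d2 , v2 , e2) =
  d1 ++ d2 , AllP.++⁺ v1 v2 , λ m mo → trans (eval-++ d1 d2 m) (cong₂ ℚ._+_ (e1 m mo) (e2 m mo))

negateD : Decomp → Decomp
negateD = map (λ p → proj₁ p , negate (proj₂ p))

timesMono-negate : ∀ g e m → timesMono (negate g) e m ≡ ℚ.- timesMono g e m
timesMono-negate g e m with divide m e
... | just _ = refl
... | nothing = refl

eval-negateD : ∀ d m → evalDecomp (negateD d) m ≡ ℚ.- evalDecomp d m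
eval-negateD [] m = refl
eval-negateD ((e , g) ∷ d) m =
  trans (cong₂ ℚ._+_ (timesMono-negate g e m) (eval-negateD d m)) (sym (ℚP.neg-distrib-+ (timesMono g e m) (evalDecomp d m)))

negateD-valid : ∀ d → All ValidTerm d → All ValidTerm (negateD d)
negateD-valid [] [] = []
negateD-valid (_ ∷ d) ((mo , q) ∷ v) = (mo , QSymMinus-negate q) ∷ negateD-valid d v

Decomposable-negate : ∀ {f} → Decomposable f → Decomposable (negate f)
Decomposable-negate (d , v , e) = negateD d , negateD-valid d v , λ m mo → trans (eval-negateD d m) (cong ℚ.-_ (e m mo))

mulVarD : ℤ → Decomp → Decomp
mulVarD v = map (λ p → insert v (proj₁ p) , proj₂ p)

mulVarD-valid : ∀ v d → All ValidTerm d → All ValidTerm (mulVarD v d)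
mulVarD-valid v [] [] = []
mulVarD-valid v ((e , _) ∷ d) ((mo , q) ∷ vd) = (insert-Mono v e mo , q) ∷ mulVarD-valid v d vd

timesMono-insert : ∀ v g e m → Mono m → timesMono g (insert v e) m ≡ maybe′ (timesMono g e) 0ℚ (m / (v ∷ []))
timesMono-insert v g e m mo = begin
  timesMono g (insert v e) m                ≡⟨ timesMono≡maybe g (insert v e) m ⟩
  maybe′ g 0ℚ (m / insert v e)              ≡⟨ cong (maybe′ g 0ℚ) (/-insert v e m mo) ⟩
  maybe′ g 0ℚ (m / (v ∷ []) >>= _/ e)       ≡⟨ maybe′->>= (m / (v ∷ [])) ⟩
  maybe′ (timesMono g e) 0ℚ (m / (v ∷ []))  ∎
  where
  open ≡-Reasoning
  maybe′->>= : ∀ X → maybe′ g 0ℚ (X >>= _/ e) ≡ maybe′ (timesMono g e) 0ℚ X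
  maybe′->>= nothing = refl
  maybe′->>= (just w) = sym (timesMono≡maybe g e w)

eval-mulVarD : ∀ v d m → Mono m → evalDecomp (mulVarD v d) m ≡ maybe′ (evalDecomp d) 0ℚ (m / (v ∷ []))
eval-mulVarD v [] m _ with m / (v ∷ [])
... | just _ = refl
... | nothing = refl
eval-mulVarD v ((e , g) ∷ d) m mo =
  trans (cong₂ ℚ._+_ (timesMono-insert v g e m mo) (eval-mulVarD v d m mo)) (maybe′-+ (m / (v ∷ [])))
  where
  maybe′-+ : ∀ X → maybe′ (timesMono g e) 0ℚ X ℚ.+ maybe′ (evalDecomp d) 0ℚ X ≡ maybe′ (evalDecomp ((e , g) ∷ d)) 0ℚ X
  maybe′-+ nothing = 0+0
  maybe′-+ (just w) = refl

Decomposable-mulVar : ∀ {f} v → Decomposable f → Decomposable (mulVar v f)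
Decomposable-mulVar {f} v (d , vd , d≈f) = mulVarD v d , mulVarD-valid v d vd , λ m mo → trans (eval-mulVarD v d m mo) (quotients-agree m mo)
  where
  quotients-agree : ∀ m → Mono m → maybe′ (evalDecomp d) 0ℚ (m / (v ∷ [])) ≡ maybe′ f 0ℚ (m / (v ∷ []))
  quotients-agree m mo with m / (v ∷ []) in eq
  ... | nothing = refl
  ... | just w = d≈f w (divide-Mono m (v ∷ []) w mo eq)

addTerm : List ℤ → Series → Decomp → Decomp
addTerm e g [] = (e , g) ∷ []
addTerm e g ((e' , g') ∷ d) with LP.≡-dec ℤ._≟_ e e'
... | yes _ = (e' , g ⊕ g') ∷ d
... | no _ = (e' , g') ∷ addTerm e g d

merge : Decomp → Decomp
merge [] = []
merge ((e , g) ∷ d) = addTerm e g (merge d)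

addTerm-valid : ∀ e g d → ValidTerm (e , g) → All ValidTerm d → All ValidTerm (addTerm e g d)
addTerm-valid e g [] p [] = p ∷ []
addTerm-valid e g ((e' , g') ∷ d) p ((mo , q) ∷ vd) with LP.≡-dec ℤ._≟_ e e'
... | yes _ = (mo , QSymMinus-⊕ (proj₂ p) q) ∷ vd
... | no _ = (mo , q) ∷ addTerm-valid e g d p vd

addTerm-keys : ∀ (P : List ℤ → Set) e g d → P e → All (λ q → P (proj₁ q)) d → All (λ q → P (proj₁ q)) (addTerm e g d)
addTerm-keys P e g [] pe [] = pe ∷ []
addTerm-keys P e g ((e' , g') ∷ d) pe (p ∷ al) with LP.≡-dec ℤ._≟_ e e'
... | yes _ = p ∷ al
... | no _ = p ∷ addTerm-keys P e g d pe al

DistinctKeys : Decomp → Set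
DistinctKeys = AllPairs (λ p q → proj₁ p ≢ proj₁ q)

addTerm-distinct : ∀ e g d → DistinctKeys d → DistinctKeys (addTerm e g d)
addTerm-distinct e g [] [] = [] ∷ []
addTerm-distinct e g ((e' , g') ∷ d) (a ∷ ap) with LP.≡-dec ℤ._≟_ e e'
... | yes _ = a ∷ ap
... | no ne = addTerm-keys (λ k → e' ≢ k) e g d (λ eq → ne (sym eq)) a ∷ addTerm-distinct e g d ap

timesMono-⊕ : ∀ g h e m → timesMono (g ⊕ h) e m ≡ timesMono g e m ℚ.+ timesMono h e m
timesMono-⊕ g h e m with divide m e
... | just _ = refl
... | nothing = sym 0+0

eval-addTerm : ∀ e g d m → evalDecomp (addTerm e g d) m ≡ timesMono g e m ℚ.+ evalDecomp d m
eval-addTerm e g [] m = refl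
eval-addTerm e g ((e' , g') ∷ d) m with LP.≡-dec ℤ._≟_ e e'
... | yes refl = trans (cong (ℚ._+ evalDecomp d m) (timesMono-⊕ g g' e m)) (ℚP.+-assoc (timesMono g e m) (timesMono g' e m) (evalDecomp d m))
... | no _ = trans (cong (timesMono g' e' m ℚ.+_) (eval-addTerm e g d m)) (x∙yz≈y∙xz (timesMono g' e' m) (timesMono g e m) (evalDecomp d m))

eval-merge : ∀ d m → evalDecomp (merge d) m ≡ evalDecomp d m
eval-merge [] m = refl
eval-merge ((e , g) ∷ d) m = trans (eval-addTerm e g (merge d) m) (cong (timesMono g e m ℚ.+_) (eval-merge d m))

merge-valid : ∀ d → All ValidTerm d → All ValidTerm (merge d) × DistinctKeys (merge d)
merge-valid [] [] = [] , []
merge-valid ((e , g) ∷ d) (p ∷ vd) =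
  addTerm-valid e g (merge d) p (proj₁ (merge-valid d vd)) , addTerm-distinct e g (merge d) (proj₂ (merge-valid d vd))

Decomposable⇒valid : ∀ {f} → Decomposable f → Σ Decomp λ d → ValidDecomp d × evalDecomp d ≈ f
Decomposable⇒valid (d , vd , e) = merge d , merge-valid d vd , λ m mo → trans (eval-merge d m) (e m mo)

-- Lowering the caps of a pattern

lowerCaps : ℤ → Pattern → Pattern
lowerCaps v = map (λ p → proj₁ p ℤ.⊓ ℤ.pred v , proj₂ p)

-- `top v P` is the part of `series P` on monomials whose largest variable is x_v
-- (provided the first cap is ≥ v): after removing one x_v, what is left is
-- either below x_v and accepted by the lowered tail, or, if the next entry is
-- not strict, again of the same kind.
mutual
  top : ℤ → Pattern → Series
  top v [] = zeroS
  top v ((d , _) ∷ P) = if ⌊ v ℤ.≤? d ⌋ then mulVar v (series (lowerCaps v P) ⊕ topIfWeak v P) else zeroS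

  topIfWeak : ℤ → Pattern → Series
  topIfWeak v [] = zeroS
  topIfWeak v ((d , f) ∷ P) = if f then zeroS else top v ((d , f) ∷ P)

≤cap⇔≤lowerCap : ∀ {v} d {i} → i ℤ.< v → ⌊ i ℤ.≤? d ⌋ ≡ ⌊ i ℤ.≤? d ℤ.⊓ ℤ.pred v ⌋
≤cap⇔≤lowerCap {v} d {i} i<v =
  isYes-⇔ (i ℤ.≤? d) (i ℤ.≤? d ℤ.⊓ ℤ.pred v) (λ i≤d → ℤP.⊓-glb i≤d (ℤP.i<j⇒i≤pred[j] i<v)) (ℤP.i≤j⊓k⇒i≤j d (ℤ.pred v))

accepts-lowerCaps : ∀ v P m → All (ℤ._< v) m → accepts P m ≡ accepts (lowerCaps v P) m
accepts-lowerCaps v [] [] _ = refl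
accepts-lowerCaps v [] (_ ∷ _) _ = refl
accepts-lowerCaps v (_ ∷ _) [] _ = refl
accepts-lowerCaps v ((d , _) ∷ []) (i ∷ []) (i<v ∷ _) = ≤cap⇔≤lowerCap d i<v
accepts-lowerCaps v ((d , _) ∷ []) (i ∷ _ ∷ _) _ = refl
accepts-lowerCaps v ((d , _) ∷ _ ∷ _) (i ∷ []) _ = refl
accepts-lowerCaps v ((d , _) ∷ (d' , f) ∷ P) (i ∷ i' ∷ m) (i<v ∷ m<v) =
  cong₂ (λ a b → a ∧ ⌊ i' ℤ.≤? i ⌋ ∧ (if f then ⌊ i' ℤ.<? i ⌋ else true) ∧ b)
    (≤cap⇔≤lowerCap d i<v) (accepts-lowerCaps v ((d' , f) ∷ P) (i' ∷ m) m<v)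

accepts-head>cap : ∀ d f P a w → d ℤ.< a → accepts ((d , f) ∷ P) (a ∷ w) ≡ false
accepts-head>cap d f [] a [] d<a = isYes-false (a ℤ.≤? d) (ℤP.<⇒≱ d<a)
accepts-head>cap d f [] a (_ ∷ _) _ = refl
accepts-head>cap d f (_ ∷ _) a [] _ = refl
accepts-head>cap d f (_ ∷ _) a (_ ∷ _) d<a rewrite isYes-false (a ℤ.≤? d) (ℤP.<⇒≱ d<a) = refl

series-head>caps : ∀ P a w → All (ℤ._< a) (caps P) → series P (a ∷ w) ≡ 0ℚ
series-head>caps [] a w _ = refl
series-head>caps ((d , f) ∷ P) a w (d<a ∷ _) = cong indicator (accepts-head>cap d f P a w d<a)

pred< : ∀ v → ℤ.pred v ℤ.< v
pred< v = ℤP.i≤pred[j]⇒i<j ℤP.≤-refl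

lowerCaps< : ∀ v P a → v ℤ.≤ a → All (ℤ._< a) (caps (lowerCaps v P))
lowerCaps< v [] a _ = []
lowerCaps< v ((d , _) ∷ P) a v≤a =
  ℤP.≤-<-trans (ℤP.i⊓j≤j d (ℤ.pred v)) (ℤP.<-≤-trans (pred< v) v≤a) ∷ lowerCaps< v P a v≤a

series-lowerCaps-≥ : ∀ v P a w → v ℤ.≤ a → series (lowerCaps v P) (a ∷ w) ≡ 0ℚ
series-lowerCaps-≥ v P a w v≤a = series-head>caps (lowerCaps v P) a w (lowerCaps< v P a v≤a)

mutual
  top-> : ∀ v P a w → v ℤ.< a → top v P (a ∷ w) ≡ 0ℚ
  top-> v [] a w _ = refl
  top-> v ((d , _) ∷ P) a w v<a with ⌊ v ℤ.≤? d ⌋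
  ... | false = refl
  ... | true = trans (cong (maybe′ _ 0ℚ) (divide-> w [] v<a)) (rest (divide w (v ∷ [])))
    where
    rest : ∀ X → maybe′ (series (lowerCaps v P) ⊕ topIfWeak v P) 0ℚ (M.map (a ∷_) X) ≡ 0ℚ
    rest nothing = refl
    rest (just w′) = trans (cong₂ ℚ._+_ (series-lowerCaps-≥ v P a w′ (ℤP.<⇒≤ v<a)) (topIfWeak-> v P a w′ v<a)) 0+0

  topIfWeak-> : ∀ v P a w → v ℤ.< a → topIfWeak v P (a ∷ w) ≡ 0ℚ
  topIfWeak-> v [] a w _ = refl
  topIfWeak-> v ((d , true) ∷ P) a w _ = refl
  topIfWeak-> v ((d , false) ∷ P) a w v<a = top-> v ((d , false) ∷ P) a w v<a

top-< : ∀ v P a w → a ℤ.< v → top v P (a ∷ w) ≡ 0ℚ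
top-< v [] a w _ = refl
top-< v ((d , _) ∷ P) a w a<v with ⌊ v ℤ.≤? d ⌋
... | false = refl
... | true = cong (maybe′ _ 0ℚ) (divide-< w [] a<v)

top-[] : ∀ v P → top v P [] ≡ 0ℚ
top-[] v [] = refl
top-[] v ((d , _) ∷ P) with ⌊ v ℤ.≤? d ⌋
... | false = refl
... | true = refl

topIfWeak-[] : ∀ v P → topIfWeak v P [] ≡ 0ℚ
topIfWeak-[] v [] = refl
topIfWeak-[] v ((d , true) ∷ P) = refl
topIfWeak-[] v ((d , false) ∷ P) = top-[] v ((d , false) ∷ P)

below : ∀ {v b w} → b ℤ.< v → Mono (b ∷ w) → All (ℤ._< v) (b ∷ w)
below b<v mo = b<v ∷ All.map (λ x≤b → ℤP.≤-<-trans x≤b b<v) (Mono⇒≤head mo)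

series-top : ∀ v P → All (ℤ._≤ v) (caps P) → ∀ w → Mono (v ∷ w) → series P (v ∷ w) ≡ top v P (v ∷ w)
series-∷-top : ∀ v d f → v ℤ.≤ d → ∀ P → All (ℤ._≤ v) (caps P) → ∀ w → Mono (v ∷ w) →
               series ((d , f) ∷ P) (v ∷ w) ≡ series (lowerCaps v P) w ℚ.+ topIfWeak v P w

series-top v [] _ w mo = refl
series-top v ((d , f) ∷ P) (_ ∷ P≤v) w mo with v ℤ.≤? d
... | no v≰d = cong indicator (accepts-head>cap d f P v w (ℤP.≰⇒> v≰d))
... | yes v≤d = trans (series-∷-top v d f v≤d P P≤v w mo) (sym (cong (maybe′ _ 0ℚ) (divide-≡ v w [])))

series-∷-top v d f v≤d [] _ [] mo rewrite isYes-true (v ℤ.≤? d) v≤d = x≡x+0 1ℚ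
series-∷-top v d f v≤d (p ∷ P) _ [] mo = trans (x≡0+x 0ℚ) (cong (0ℚ ℚ.+_) (sym (topIfWeak-[] v (p ∷ P))))
series-∷-top v d f v≤d [] _ (b ∷ w) mo = sym 0+0
series-∷-top v d f v≤d ((d' , f') ∷ P) P≤v (b ∷ w) mo with compare b v
... | tri> _ _ v<b = ⊥-elim (ℤP.<⇒≱ v<b (Mono⇒≤ mo))
... | tri< b<v _ _ rewrite isYes-true (v ℤ.≤? d) v≤d | isYes-true (b ℤ.≤? v) (ℤP.<⇒≤ b<v) with f'
...   | true rewrite isYes-true (b ℤ.<? v) b<v =
  trans (cong indicator (accepts-lowerCaps v ((d' , true) ∷ P) (b ∷ w) (below b<v (Mono-tail mo)))) (x≡x+0 _)
...   | false = begin
  series ((d' , false) ∷ P) (b ∷ w)                                    ≡⟨ cong indicator (accepts-lowerCaps v ((d' , false) ∷ P) (b ∷ w) (below b<v (Mono-tail mo))) ⟩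
  series (lowerCaps v ((d' , false) ∷ P)) (b ∷ w)                      ≡⟨ x≡x+0 _ ⟩
  series (lowerCaps v ((d' , false) ∷ P)) (b ∷ w) ℚ.+ 0ℚ               ≡⟨ cong (series (lowerCaps v ((d' , false) ∷ P)) (b ∷ w) ℚ.+_) (top-< v ((d' , false) ∷ P) b w b<v) ⟨
  series (lowerCaps v ((d' , false) ∷ P)) (b ∷ w) ℚ.+ top v ((d' , false) ∷ P) (b ∷ w) ∎
  where open ≡-Reasoning
series-∷-top v d f v≤d ((d' , f') ∷ P) P≤v (b ∷ w) mo | tri≈ _ refl _
  rewrite isYes-true (v ℤ.≤? d) v≤d | isYes-true (v ℤ.≤? v) ℤP.≤-refl with f'
...   | true rewrite isYes-false (v ℤ.<? v) (ℤP.<-irrefl refl) =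
  trans (sym 0+0) (cong (ℚ._+ 0ℚ) (sym (series-lowerCaps-≥ v ((d' , true) ∷ P) v w ℤP.≤-refl)))
...   | false = begin
  series ((d' , false) ∷ P) (v ∷ w)                                    ≡⟨ series-top v ((d' , false) ∷ P) P≤v w (Mono-tail mo) ⟩
  top v ((d' , false) ∷ P) (v ∷ w)                                     ≡⟨ x≡0+x _ ⟩
  0ℚ ℚ.+ top v ((d' , false) ∷ P) (v ∷ w)                              ≡⟨ cong (ℚ._+ top v ((d' , false) ∷ P) (v ∷ w)) (series-lowerCaps-≥ v ((d' , false) ∷ P) v w ℤP.≤-refl) ⟨
  series (lowerCaps v ((d' , false) ∷ P)) (v ∷ w) ℚ.+ top v ((d' , false) ∷ P) (v ∷ w) ∎
  where open ≡-Reasoning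

lowering : ∀ v P → All (ℤ._≤ v) (caps P) → ∀ m → Mono m → series P m ≡ series (lowerCaps v P) m ℚ.+ top v P m
lowering v [] _ [] _ = x≡x+0 1ℚ
lowering v (p ∷ P) _ [] _ = trans (sym 0+0) (cong (0ℚ ℚ.+_) (sym (top-[] v (p ∷ P))))
lowering v P P≤v (a ∷ w) mo with compare a v
... | tri< a<v _ _ = begin
  series P (a ∷ w)                                  ≡⟨ cong indicator (accepts-lowerCaps v P (a ∷ w) (below a<v mo)) ⟩
  series (lowerCaps v P) (a ∷ w)                    ≡⟨ x≡x+0 _ ⟩
  series (lowerCaps v P) (a ∷ w) ℚ.+ 0ℚ             ≡⟨ cong (series (lowerCaps v P) (a ∷ w) ℚ.+_) (top-< v P a w a<v) ⟨
  series (lowerCaps v P) (a ∷ w) ℚ.+ top v P (a ∷ w) ∎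
  where open ≡-Reasoning
... | tri> _ _ v<a = begin
  series P (a ∷ w)                                  ≡⟨ series-head>caps P a w (All.map (λ d≤v → ℤP.≤-<-trans d≤v v<a) P≤v) ⟩
  0ℚ                                                ≡⟨ 0+0 ⟨
  0ℚ ℚ.+ 0ℚ                                         ≡⟨ cong₂ ℚ._+_ (series-lowerCaps-≥ v P a w (ℤP.<⇒≤ v<a)) (top-> v P a w v<a) ⟨
  series (lowerCaps v P) (a ∷ w) ℚ.+ top v P (a ∷ w) ∎
  where open ≡-Reasoning
... | tri≈ _ refl _ = begin
  series P (v ∷ w)                                  ≡⟨ series-top v P P≤v w mo ⟩
  top v P (v ∷ w)                                   ≡⟨ x≡0+x _ ⟩
  0ℚ ℚ.+ top v P (v ∷ w)                            ≡⟨ cong (ℚ._+ top v P (v ∷ w)) (series-lowerCaps-≥ v P v w ℤP.≤-refl) ⟨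
  series (lowerCaps v P) (v ∷ w) ℚ.+ top v P (v ∷ w) ∎
  where open ≡-Reasoning


SameOrder : ℤ → ℤ → ℤ → ℤ → Set
SameOrder x x' y y' = ((x ≡ y) × (x' ≡ y')) ⊎ ((x ℤ.< y) × (x' ℤ.< y')) ⊎ ((y ℤ.< x) × (y' ℤ.< x'))

SameOrder-≤ : ∀ {x x' y y'} → SameOrder x x' y y' → ⌊ y ℤ.≤? x ⌋ ≡ ⌊ y' ℤ.≤? x' ⌋
SameOrder-≤ {x} {x'} {y} {y'} same with same
... | inj₁ (refl , refl) = isYes-⇔ (y ℤ.≤? y) (y' ℤ.≤? y') (λ _ → ℤP.≤-refl) (λ _ → ℤP.≤-refl)
... | inj₂ (inj₁ (x<y , x'<y')) = isYes-⇔ (y ℤ.≤? x) (y' ℤ.≤? x') (λ y≤x → ⊥-elim (ℤP.<⇒≱ x<y y≤x)) (λ y'≤x' → ⊥-elim (ℤP.<⇒≱ x'<y' y'≤x'))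
... | inj₂ (inj₂ (y<x , y'<x')) = isYes-⇔ (y ℤ.≤? x) (y' ℤ.≤? x') (λ _ → ℤP.<⇒≤ y'<x') (λ _ → ℤP.<⇒≤ y<x)

SameOrder-< : ∀ {x x' y y'} → SameOrder x x' y y' → ⌊ y ℤ.<? x ⌋ ≡ ⌊ y' ℤ.<? x' ⌋
SameOrder-< {x} {x'} {y} {y'} same with same
... | inj₁ (refl , refl) = isYes-⇔ (y ℤ.<? y) (y' ℤ.<? y') (λ y<y → ⊥-elim (ℤP.<-irrefl refl y<y)) (λ y'<y' → ⊥-elim (ℤP.<-irrefl refl y'<y'))
... | inj₂ (inj₁ (x<y , x'<y')) = isYes-⇔ (y ℤ.<? x) (y' ℤ.<? x') (λ y<x → ⊥-elim (ℤP.<-asym x<y y<x)) (λ y'<x' → ⊥-elim (ℤP.<-asym x'<y' y'<x'))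
... | inj₂ (inj₂ (y<x , y'<x')) = isYes-⇔ (y ℤ.<? x) (y' ℤ.<? x') (λ _ → y'<x') (λ _ → y<x)

-- A pattern with all caps 0 only sees the relative order of the entries of a
-- monomial in x₋, so it accepts any two monomials related entrywise by an
-- order-preserving R.
module OrderInvariance (R : ℤ → ℤ → Set)
  (sameOrder : ∀ {x x' y y'} → R x x' → R y y' → SameOrder x x' y y')
  (nonpositive : ∀ {x x'} → R x x' → (x ℤ.≤ + 0) × (x' ℤ.≤ + 0)) where

  ≤0⇔≤0 : ∀ {x x'} → R x x' → ⌊ x ℤ.≤? + 0 ⌋ ≡ ⌊ x' ℤ.≤? + 0 ⌋
  ≤0⇔≤0 {x} {x'} r = trans (isYes-true (x ℤ.≤? + 0) (proj₁ (nonpositive r))) (sym (isYes-true (x' ℤ.≤? + 0) (proj₂ (nonpositive r))))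

  accepts-constPattern0-resp : ∀ fs {m m'} → Pointwise R m m' →
                               accepts (constPattern (+ 0) fs) m ≡ accepts (constPattern (+ 0) fs) m'
  accepts-constPattern0-resp [] [] = refl
  accepts-constPattern0-resp [] (_ ∷ _) = refl
  accepts-constPattern0-resp (f ∷ fs) [] = refl
  accepts-constPattern0-resp (f ∷ []) (r ∷ []) = ≤0⇔≤0 r
  accepts-constPattern0-resp (f ∷ []) (r ∷ _ ∷ _) = refl
  accepts-constPattern0-resp (f ∷ _ ∷ _) (r ∷ []) = refl
  accepts-constPattern0-resp (f ∷ f' ∷ fs) (r ∷ r' ∷ rs) =
    cong₂ _∧_ (≤0⇔≤0 r)
      (cong₂ _∧_ (SameOrder-≤ (sameOrder r r'))
        (cong₂ _∧_ (cong (λ b → if f' then b else true) (SameOrder-< (sameOrder r r')))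
          (accepts-constPattern0-resp (f' ∷ fs) (r' ∷ rs))))

data Aligned : List ℤ → List ℤ → ℤ → ℤ → Set where
  at-head : ∀ {i j is js} → Aligned (i ∷ is) (j ∷ js) i j
  at-tail : ∀ {i j is js x y} → Aligned is js x y → Aligned (i ∷ is) (j ∷ js) x y

Aligned-All : ∀ {P Q : ℤ → Set} {is js x y} → Aligned is js x y → All P is → All Q js → P x × Q y
Aligned-All at-head (p ∷ _) (q ∷ _) = p , q
Aligned-All (at-tail z) (_ ∷ ps) (_ ∷ qs) = Aligned-All z ps qs

Linked<⇒All : ∀ {i is} → Linked ℤ._<_ (i ∷ is) → All (i ℤ.<_) is
Linked<⇒All [-] = []
Linked<⇒All (r ∷ l) = LinkedP.Linked⇒All ℤP.<-trans r l

Linked-tail : ∀ {R : ℤ → ℤ → Set} {i is} → Linked R (i ∷ is) → Linked R is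
Linked-tail [-] = []
Linked-tail (_ ∷ l) = l

Aligned-SameOrder : ∀ {is js x x' y y'} → Linked ℤ._<_ is → Linked ℤ._<_ js →
                    Aligned is js x x' → Aligned is js y y' → SameOrder x x' y y'
Aligned-SameOrder li lj at-head at-head = inj₁ (refl , refl)
Aligned-SameOrder li lj at-head (at-tail z) = inj₂ (inj₁ (Aligned-All z (Linked<⇒All li) (Linked<⇒All lj)))
Aligned-SameOrder li lj (at-tail z) at-head = inj₂ (inj₂ (Aligned-All z (Linked<⇒All li) (Linked<⇒All lj)))
Aligned-SameOrder li lj (at-tail z) (at-tail z') = Aligned-SameOrder (Linked-tail li) (Linked-tail lj) z z'

blocks : List ℤ → List ℕ → List ℤ
blocks is a = concat (zipWith (λ i k → replicate k i) is a)

Pointwise-replicate : ∀ {R : ℤ → ℤ → Set} {x y} n → R x y → Pointwise R (replicate n x) (replicate n y)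
Pointwise-replicate zero r = []
Pointwise-replicate (suc n) r = r ∷ Pointwise-replicate n r

Pointwise-blocks : ∀ (a : List ℕ) is js → length is ≡ length a → length js ≡ length a →
                   Pointwise (Aligned is js) (blocks is a) (blocks js a)
Pointwise-blocks [] [] [] _ _ = []
Pointwise-blocks (k ∷ a) (i ∷ is) (j ∷ js) e e′ =
  PW.++⁺ (Pointwise-replicate k at-head) (PW.map at-tail (Pointwise-blocks a is js (ℕP.suc-injective e) (ℕP.suc-injective e′)))

≤caps-constPattern : ∀ t fs m → Pointwise (λ p i → i ℤ.≤ proj₁ p) (constPattern t fs) m → All (ℤ._≤ t) m
≤caps-constPattern t [] [] [] = []
≤caps-constPattern t (f ∷ fs) (i ∷ m) (r ∷ rs) = r ∷ ≤caps-constPattern t fs m rs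

All≤0⇒¬Any>0 : ∀ {m} → All (ℤ._≤ + 0) m → ¬ Any (+ 0 ℤ.<_) m
All≤0⇒¬Any>0 (p ∷ _) (here q) = ℤP.<⇒≱ q p
All≤0⇒¬Any>0 (_ ∷ ps) (there q) = All≤0⇒¬Any>0 ps q

QSymMinus-constPattern0 : ∀ fs → QSymMinus (series (constPattern (+ 0) fs))
QSymMinus-constPattern0 fs = record
  { boundedDeg = length fs , boundedDeg
  ; onlyMinus = onlyMinus
  ; quasisym = λ a is js _ li lj is≤0 js≤0 li≡la lj≡la → cong indicator
      (OrderInvariance.accepts-constPattern0-resp (Aligned is js) (Aligned-SameOrder li lj) (λ z → Aligned-All z is≤0 js≤0)
        fs (PW.reverse⁺ (Pointwise-blocks a is js li≡la lj≡la)))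
  }
  where
  P = constPattern (+ 0) fs
  boundedDeg : ∀ m → Mono m → length fs ℕ.< length m → series P m ≡ 0ℚ
  boundedDeg m _ fs<m with accepts P m in acc
  ... | false = refl
  ... | true = ⊥-elim (ℕP.<-irrefl (sym (trans (accepts⇒length P m acc) (length-constPattern (+ 0) fs))) fs<m)
  onlyMinus : ∀ m → Mono m → Any (+ 0 ℤ.<_) m → series P m ≡ 0ℚ
  onlyMinus m _ m>0 with accepts P m in acc
  ... | false = refl
  ... | true = ⊥-elim (All≤0⇒¬Any>0 (≤caps-constPattern (+ 0) fs m (accepts⇒≤caps P m acc)) m>0)


-- Existence of a decomposition

DecomposableUpTo : ℕ → Set
DecomposableUpTo n = ∀ P → length P ℕ.≤ n → Decomposable (series P)

length-lowerCaps : ∀ v P → length (lowerCaps v P) ≡ length P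
length-lowerCaps v P = LP.length-map _ P

mutual
  top-decomposable : ∀ {n} v P → DecomposableUpTo n → length P ℕ.≤ suc n → Decomposable (top v P)
  top-decomposable v [] ih _ = Decomposable-zero
  top-decomposable {n} v ((d , f) ∷ P) ih (ℕ.s≤s P≤n) with ⌊ v ℤ.≤? d ⌋
  ... | false = Decomposable-zero
  ... | true = Decomposable-mulVar v
    (Decomposable-⊕ (ih (lowerCaps v P) (subst (ℕ._≤ n) (sym (length-lowerCaps v P)) P≤n))
                    (topIfWeak-decomposable v P ih P≤n))

  topIfWeak-decomposable : ∀ {n} v P → DecomposableUpTo n → length P ℕ.≤ n → Decomposable (topIfWeak v P)
  topIfWeak-decomposable v [] ih _ = Decomposable-zero
  topIfWeak-decomposable v ((d , true) ∷ P) ih _ = Decomposable-zero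
  topIfWeak-decomposable v ((d , false) ∷ P) ih P≤n = top-decomposable v ((d , false) ∷ P) ih (ℕP.m≤n⇒m≤1+n P≤n)

x≡y+z⇒y≡x-z : ∀ x y z → x ≡ y ℚ.+ z → y ≡ x ℚ.+ ℚ.- z
x≡y+z⇒y≡x-z x y z x≡y+z = begin
  y                         ≡⟨ ℚP.+-identityʳ y ⟨
  y ℚ.+ 0ℚ                  ≡⟨ cong (y ℚ.+_) (ℚP.+-inverseʳ z) ⟨
  y ℚ.+ (z ℚ.+ ℚ.- z)       ≡⟨ ℚP.+-assoc y z (ℚ.- z) ⟨
  (y ℚ.+ z) ℚ.+ ℚ.- z       ≡⟨ cong (ℚ._+ ℚ.- z) x≡y+z ⟨
  x ℚ.+ ℚ.- z               ∎
  where open ≡-Reasoning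

caps-constPattern : ∀ t fs → All (ℤ._≤ t) (caps (constPattern t fs))
caps-constPattern t [] = []
caps-constPattern t (f ∷ fs) = ℤP.≤-refl ∷ caps-constPattern t fs

lowerCaps-constPattern : ∀ v fs → lowerCaps v (constPattern v fs) ≡ constPattern (ℤ.pred v) fs
lowerCaps-constPattern v [] = refl
lowerCaps-constPattern v (f ∷ fs) =
  cong₂ _∷_ (cong (_, f) (ℤP.i≥j⇒i⊓j≡j (ℤP.<⇒≤ (pred< v)))) (lowerCaps-constPattern v fs)

pred-neg : ∀ k → ℤ.pred (ℤ.- (+ k)) ≡ ℤ.- (+ suc k)
pred-neg zero = refl
pred-neg (suc k) = refl

-- Lowering the constant cap −k by one subtracts `top (−k)`; at cap 0 the
-- series is quasisymmetric.
constPattern-decomposable : ∀ {n} → DecomposableUpTo n → ∀ k fs → length fs ℕ.≤ suc n →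
                            Decomposable (series (constPattern (ℤ.- (+ k)) fs))
constPattern-decomposable ih zero fs _ = Decomposable-qsym (QSymMinus-constPattern0 fs)
constPattern-decomposable {n} ih (suc k) fs fs≤1+n =
  Decomposable-resp lowered
    (Decomposable-⊕ (constPattern-decomposable ih k fs fs≤1+n)
                    (Decomposable-negate (top-decomposable v P ih (subst (ℕ._≤ suc n) (sym (length-constPattern v fs)) fs≤1+n))))
  where
  v = ℤ.- (+ k)
  P = constPattern v fs
  lowered : ∀ m → Mono m → (series P ⊕ negate (top v P)) m ≡ series (constPattern (ℤ.- (+ suc k)) fs) m
  lowered m mo = sym (begin
    series (constPattern (ℤ.- (+ suc k)) fs) m  ≡⟨ cong (λ t → series (constPattern t fs) m) (pred-neg k) ⟨
    series (constPattern (ℤ.pred v) fs) m       ≡⟨ cong (λ Q → series Q m) (lowerCaps-constPattern v fs) ⟨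
    series (lowerCaps v P) m                    ≡⟨ x≡y+z⇒y≡x-z _ _ _ (lowering v P (caps-constPattern v fs) m mo) ⟩
    series P m ℚ.+ ℚ.- top v P m                ∎)
    where open ≡-Reasoning

≡constPattern : ∀ t P → All (t ≡_) (caps P) → P ≡ constPattern t (map proj₂ P)
≡constPattern t [] [] = refl
≡constPattern t ((d , f) ∷ P) (refl ∷ P≡t) = cong ((d , f) ∷_) (≡constPattern t P P≡t)

pred-+suc : ∀ a s → ℤ.pred (a ℤ.+ + suc s) ≡ a ℤ.+ + s
pred-+suc a s = -1+[a+[1+b]]≡a+b a (+ s)
  where
  -1+[a+[1+b]]≡a+b : ∀ a b → ℤ.-1ℤ ℤ.+ (a ℤ.+ (ℤ.1ℤ ℤ.+ b)) ≡ a ℤ.+ b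
  -1+[a+[1+b]]≡a+b = solve-∀

Between : ℤ → ℕ → ℤ → Set
Between a s d = (a ℤ.≤ d) × (d ℤ.≤ a ℤ.+ + s)

lowerCap-Between : ∀ a s d → Between a (suc s) d → Between a s (d ℤ.⊓ ℤ.pred (a ℤ.+ + suc s))
lowerCap-Between a s d (a≤d , _) =
  ℤP.⊓-glb a≤d (subst (a ℤ.≤_) (sym (pred-+suc a s)) (ℤP.i≤i+j a (+ s))) ,
  subst (d ℤ.⊓ ℤ.pred (a ℤ.+ + suc s) ℤ.≤_) (pred-+suc a s) (ℤP.i⊓j≤j d _)

-- Induction on the width s of the window of caps: lower the caps above a + s.
boundedPattern-decomposable : ∀ {n} → DecomposableUpTo n → ∀ k s P → length P ℕ.≤ suc n →
                              All (Between (ℤ.- (+ k)) s) (caps P) → Decomposable (series P)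
boundedPattern-decomposable ih k zero P P≤1+n between =
  subst (Decomposable ∘ series) (sym (≡constPattern (ℤ.- (+ k)) P caps≡-k))
    (constPattern-decomposable ih k (map proj₂ P) (subst (ℕ._≤ _) (sym (LP.length-map proj₂ P)) P≤1+n))
  where
  caps≡-k : All (ℤ.- (+ k) ≡_) (caps P)
  caps≡-k = All.map (λ { (lo , hi) → ℤP.≤-antisym lo (subst (_ ℤ.≤_) (ℤP.+-identityʳ _) hi) }) between
boundedPattern-decomposable ih k (suc s) P P≤1+n between =
  Decomposable-resp (λ m mo → sym (lowering v P (All.map proj₂ between) m mo))
    (Decomposable-⊕ (boundedPattern-decomposable ih k s (lowerCaps v P) (subst (ℕ._≤ _) (sym (length-lowerCaps v P)) P≤1+n) lowered)
                    (top-decomposable v P ih P≤1+n))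
  where
  v = ℤ.- (+ k) ℤ.+ + suc s
  lowered : All (Between (ℤ.- (+ k)) s) (caps (lowerCaps v P))
  lowered = AllP.map⁺ (AllP.map⁺ (All.map (λ {p} → lowerCap-Between (ℤ.- (+ k)) s (proj₁ p)) (AllP.map⁻ between)))

≤sum : ∀ ns → All (ℕ._≤ sum ns) ns
≤sum [] = []
≤sum (n ∷ ns) = ℕP.m≤m+n n (sum ns) ∷ All.map (λ m≤ → ℕP.≤-trans m≤ (ℕP.m≤n+m (sum ns) n)) (≤sum ns)

∣∣≤⇒Between : ∀ k d → ∣ d ∣ ℕ.≤ k → Between (ℤ.- (+ k)) (k ℕ.+ k) d
∣∣≤⇒Between k d ∣d∣≤k = -k≤ d ∣d∣≤k , subst (d ℤ.≤_) (sym (-x+[x+x]≡x (+ k))) (≤k d ∣d∣≤k)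
  where
  -x+[x+x]≡x : ∀ x → ℤ.- x ℤ.+ (x ℤ.+ x) ≡ x
  -x+[x+x]≡x = solve-∀
  -k≤ : ∀ d → ∣ d ∣ ℕ.≤ k → ℤ.- (+ k) ℤ.≤ d
  -k≤ (+ n) _ = ℤP.neg-≤-pos
  -k≤ -[1+ n ] le = ℤP.neg-mono-≤ (ℤ.+≤+ le)
  ≤k : ∀ d → ∣ d ∣ ℕ.≤ k → d ℤ.≤ + k
  ≤k (+ n) le = ℤ.+≤+ le
  ≤k -[1+ n ] _ = ℤ.-≤+

pattern-decomposable : ∀ n → DecomposableUpTo n
pattern-decomposable zero [] _ = Decomposable-qsym (QSymMinus-constPattern0 [])
pattern-decomposable (suc n) P P≤1+n =
  boundedPattern-decomposable (pattern-decomposable n) k (k ℕ.+ k) P P≤1+n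
    (All.map (λ {d} → ∣∣≤⇒Between k d) (AllP.map⁻ (≤sum (map ∣_∣ (caps P)))))
  where k = sum (map ∣_∣ (caps P))

Fback-decomposable : ∀ v → Decomposable (Fback v)
Fback-decomposable v =
  Decomposable-resp (λ m _ → cong indicator (sym (fcheck≡accepts (word v) m)))
    (pattern-decomposable (length P) P ℕP.≤-refl)
  where P = wordPattern (word v)


-- `reversedFlags L` are the strictness flags of the labels L read from right
-- to left: a strict step exactly where the label increases.
reversedFlags : List ℕ → List Bool
reversedFlags [] = []
reversedFlags (l ∷ []) = false ∷ []
reversedFlags (l ∷ l' ∷ ls) = reversedFlags (l' ∷ ls) ∷ʳ ⌊ l ℕ.<? l' ⌋

length-∷ʳ : ∀ {A : Set} (xs : List A) x → length (xs ∷ʳ x) ≡ suc (length xs)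
length-∷ʳ [] x = refl
length-∷ʳ (y ∷ xs) x = cong suc (length-∷ʳ xs x)

length-reversedPattern : ∀ L → length (constPattern (+ 0) (reversedFlags L)) ≡ length L
length-reversedPattern L = trans (length-constPattern (+ 0) (reversedFlags L)) (length-reversedFlags L)
  where
  length-reversedFlags : ∀ L → length (reversedFlags L) ≡ length L
  length-reversedFlags [] = refl
  length-reversedFlags (l ∷ []) = refl
  length-reversedFlags (l ∷ l' ∷ ls) = trans (length-∷ʳ (reversedFlags (l' ∷ ls)) _) (cong suc (length-reversedFlags (l' ∷ ls)))

last : ℤ → List ℤ → ℤ
last y [] = y
last y (z ∷ Z) = last z Z

last-∷ʳ : ∀ y Y x → last y (Y ∷ʳ x) ≡ x
last-∷ʳ y [] x = refl
last-∷ʳ y (z ∷ Z) x = last-∷ʳ z Z x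

reverse-∷ : ∀ i is → Σ ℤ λ y → Σ (List ℤ) λ Y → (reverse (i ∷ is) ≡ y ∷ Y) × (last y Y ≡ i)
reverse-∷ i is with ∷ʳ-∷ (reverse is)
  where
  ∷ʳ-∷ : ∀ R → Σ ℤ λ y → Σ (List ℤ) λ Y → (R ∷ʳ i ≡ y ∷ Y) × (last y Y ≡ i)
  ∷ʳ-∷ [] = i , [] , refl , refl
  ∷ʳ-∷ (y ∷ Y) = y , Y ∷ʳ i , refl , last-∷ʳ y Y i
... | y , Y , eq , last≡i = y , Y , trans (LP.unfold-reverse i is) eq , last≡i

accepts-∷ʳ : ∀ P d f y Y i → accepts (P ∷ʳ (d , f)) ((y ∷ Y) ∷ʳ i) ≡
             accepts P (y ∷ Y) ∧ (⌊ i ℤ.≤? last y Y ⌋ ∧ (if f then ⌊ i ℤ.<? last y Y ⌋ else true) ∧ ⌊ i ℤ.≤? d ⌋)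
accepts-∷ʳ [] d f y [] i = refl
accepts-∷ʳ (_ ∷ []) d f y [] i = refl
accepts-∷ʳ (p ∷ p' ∷ P) d f y [] i =
  accepts-length≢ (p ∷ p' ∷ P ∷ʳ (d , f)) (y ∷ i ∷ [])
    (λ e → ℕP.<-irrefl (sym e) (ℕ.s≤s (ℕ.s≤s (subst (1 ℕ.≤_) (sym (length-∷ʳ P (d , f))) (ℕ.s≤s ℕ.z≤n)))))
accepts-∷ʳ [] d f y (z ∷ Z) i = refl
accepts-∷ʳ (p ∷ []) d f y (z ∷ Z) i =
  accepts-length≢ (p ∷ (d , f) ∷ []) (y ∷ z ∷ Z ∷ʳ i)
    (λ e → ℕP.<-irrefl e (ℕ.s≤s (ℕ.s≤s (subst (1 ℕ.≤_) (sym (length-∷ʳ Z i)) (ℕ.s≤s ℕ.z≤n)))))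
accepts-∷ʳ ((d₀ , _) ∷ (d₁ , g) ∷ P) d f y (z ∷ Z) i = begin
  y≤d₀ ∧ z≤y ∧ z<y ∧ accepts ((d₁ , g) ∷ P ∷ʳ (d , f)) ((z ∷ Z) ∷ʳ i)  ≡⟨ cong (λ x → y≤d₀ ∧ z≤y ∧ z<y ∧ x) (accepts-∷ʳ ((d₁ , g) ∷ P) d f z Z i) ⟩
  y≤d₀ ∧ z≤y ∧ z<y ∧ (rest ∧ new)                                      ≡⟨ cong (λ x → y≤d₀ ∧ z≤y ∧ x) (BP.∧-assoc z<y rest new) ⟨
  y≤d₀ ∧ z≤y ∧ (z<y ∧ rest) ∧ new                                      ≡⟨ cong (y≤d₀ ∧_) (BP.∧-assoc z≤y (z<y ∧ rest) new) ⟨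
  y≤d₀ ∧ (z≤y ∧ z<y ∧ rest) ∧ new                                      ≡⟨ BP.∧-assoc y≤d₀ (z≤y ∧ z<y ∧ rest) new ⟨
  (y≤d₀ ∧ z≤y ∧ z<y ∧ rest) ∧ new                                      ∎
  where
  open ≡-Reasoning
  y≤d₀ = ⌊ y ℤ.≤? d₀ ⌋
  z≤y = ⌊ z ℤ.≤? y ⌋
  z<y = if g then ⌊ z ℤ.<? y ⌋ else true
  rest = accepts ((d₁ , g) ∷ P) (z ∷ Z)
  new = ⌊ i ℤ.≤? last z Z ⌋ ∧ (if f then ⌊ i ℤ.<? last z Z ⌋ else true) ∧ ⌊ i ℤ.≤? d ⌋

qcheck⇒nonpositive : ∀ L s → qcheck L s ≡ true → All (ℤ._≤ + 0) s
qcheck⇒nonpositive [] [] _ = []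
qcheck⇒nonpositive (l ∷ []) (i ∷ []) e = isYes⇒ (i ℤ.≤? + 0) e ∷ []
qcheck⇒nonpositive (l ∷ l' ∷ ls) (i ∷ i' ∷ is) e =
  let (i≤i' , _ , e′) = ∧≡true⇒₃ ⌊ i ℤ.≤? i' ⌋ (if ⌊ l ℕ.<? l' ⌋ then ⌊ i ℤ.<? i' ⌋ else true) (qcheck (l' ∷ ls) (i' ∷ is)) e
      is≤0 = qcheck⇒nonpositive (l' ∷ ls) (i' ∷ is) e′
  in ℤP.≤-trans (isYes⇒ (i ℤ.≤? i') i≤i') (All.head is≤0) ∷ is≤0

∧-pull : ∀ a b c q → (q ≡ true → a ≡ true → c ≡ true) → a ∧ b ∧ q ≡ q ∧ (a ∧ b ∧ c)
∧-pull false b c false _ = refl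
∧-pull false b c true _ = refl
∧-pull true b c false _ = BP.∧-zeroʳ b
∧-pull true b false true h with () ← h refl refl
∧-pull true b true true _ = refl

qcheck≡accepts-reverse : ∀ L s → qcheck L s ≡ accepts (constPattern (+ 0) (reversedFlags L)) (reverse s)
qcheck≡accepts-reverse-∷∷ : ∀ l l' ls i i' is →
  qcheck (l' ∷ ls) (i' ∷ is) ≡ accepts (constPattern (+ 0) (reversedFlags (l' ∷ ls))) (reverse (i' ∷ is)) →
  qcheck (l ∷ l' ∷ ls) (i ∷ i' ∷ is) ≡ accepts (constPattern (+ 0) (reversedFlags (l ∷ l' ∷ ls))) (reverse (i ∷ i' ∷ is))

qcheck≡accepts-reverse [] [] = refl
qcheck≡accepts-reverse [] (i ∷ is) =
  sym (accepts-length≢ [] (reverse (i ∷ is)) (λ e → ℕP.0≢1+n (trans e (LP.length-reverse (i ∷ is)))))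
qcheck≡accepts-reverse (l ∷ ls) [] =
  sym (accepts-length≢ (constPattern (+ 0) (reversedFlags (l ∷ ls))) [] (λ e → ℕP.0≢1+n (trans (sym e) (length-reversedPattern (l ∷ ls)))))
qcheck≡accepts-reverse (l ∷ []) (i ∷ []) = refl
qcheck≡accepts-reverse (l ∷ []) (i ∷ i' ∷ is) =
  sym (accepts-length≢ _ (reverse (i ∷ i' ∷ is)) (λ e → ℕP.<-irrefl (trans e (LP.length-reverse (i ∷ i' ∷ is))) (ℕ.s≤s (ℕ.s≤s ℕ.z≤n))))
qcheck≡accepts-reverse (l ∷ l' ∷ ls) (i ∷ []) =
  sym (accepts-length≢ (constPattern (+ 0) (reversedFlags (l ∷ l' ∷ ls))) (i ∷ []) (λ e → ℕP.<-irrefl (trans (sym e) (length-reversedPattern (l ∷ l' ∷ ls))) (ℕ.s≤s (ℕ.s≤s ℕ.z≤n))))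
qcheck≡accepts-reverse (l ∷ l' ∷ ls) (i ∷ i' ∷ is) =
  qcheck≡accepts-reverse-∷∷ l l' ls i i' is (qcheck≡accepts-reverse (l' ∷ ls) (i' ∷ is))

qcheck≡accepts-reverse-∷∷ l l' ls i i' is ih with reverse-∷ i' is
... | y , Y , rev≡ , last≡ = sym (begin
  accepts (constPattern (+ 0) (F ∷ʳ f)) (reverse (i ∷ i' ∷ is))
    ≡⟨ cong₂ accepts (LP.map-++ (+ 0 ,_) F (f ∷ [])) (trans (LP.unfold-reverse i (i' ∷ is)) (cong (_∷ʳ i) rev≡)) ⟩
  accepts (constPattern (+ 0) F ∷ʳ (+ 0 , f)) ((y ∷ Y) ∷ʳ i)
    ≡⟨ accepts-∷ʳ (constPattern (+ 0) F) (+ 0) f y Y i ⟩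
  accepts (constPattern (+ 0) F) (y ∷ Y) ∧ (⌊ i ℤ.≤? last y Y ⌋ ∧ (if f then ⌊ i ℤ.<? last y Y ⌋ else true) ∧ ⌊ i ℤ.≤? + 0 ⌋)
    ≡⟨ cong₂ (λ a x → a ∧ (⌊ i ℤ.≤? x ⌋ ∧ (if f then ⌊ i ℤ.<? x ⌋ else true) ∧ ⌊ i ℤ.≤? + 0 ⌋))
             (trans (cong (accepts (constPattern (+ 0) F)) (sym rev≡)) (sym ih)) last≡ ⟩
  q ∧ (⌊ i ℤ.≤? i' ⌋ ∧ (if f then ⌊ i ℤ.<? i' ⌋ else true) ∧ ⌊ i ℤ.≤? + 0 ⌋)
    ≡⟨ ∧-pull ⌊ i ℤ.≤? i' ⌋ (if f then ⌊ i ℤ.<? i' ⌋ else true) ⌊ i ℤ.≤? + 0 ⌋ q i≤0 ⟨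
  ⌊ i ℤ.≤? i' ⌋ ∧ (if f then ⌊ i ℤ.<? i' ⌋ else true) ∧ q ∎)
  where
  open ≡-Reasoning
  F = reversedFlags (l' ∷ ls)
  f = ⌊ l ℕ.<? l' ⌋
  q = qcheck (l' ∷ ls) (i' ∷ is)
  i≤0 : q ≡ true → ⌊ i ℤ.≤? i' ⌋ ≡ true → ⌊ i ℤ.≤? + 0 ⌋ ≡ true
  i≤0 accepted i≤i' with qcheck⇒nonpositive (l' ∷ ls) (i' ∷ is) accepted
  ... | i'≤0 ∷ _ = isYes-true (i ℤ.≤? + 0) (ℤP.≤-trans (isYes⇒ (i ℤ.≤? i') i≤i') i'≤0)

blockFlags : Bool → List ℕ → List Bool
blockFlags b [] = []
blockFlags b (zero ∷ ns) = blockFlags b ns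
blockFlags b (suc n ∷ ns) = b ∷ (replicate n false ++ blockFlags true ns)

anyPos : List ℕ → Bool
anyPos [] = false
anyPos (zero ∷ ns) = anyPos ns
anyPos (suc _ ∷ _) = true

blockFlags-++ : ∀ b xs ys → blockFlags b (xs ++ ys) ≡ blockFlags b xs ++ blockFlags (b ∨ anyPos xs) ys
blockFlags-++ b [] ys = cong (λ c → blockFlags c ys) (sym (BP.∨-identityʳ b))
blockFlags-++ b (zero ∷ xs) ys = blockFlags-++ b xs ys
blockFlags-++ b (suc n ∷ xs) ys = cong (b ∷_) (begin
  replicate n false ++ blockFlags true (xs ++ ys)                                 ≡⟨ cong (replicate n false ++_) (blockFlags-++ true xs ys) ⟩
  replicate n false ++ (blockFlags true xs ++ blockFlags true ys)                 ≡⟨ LP.++-assoc (replicate n false) (blockFlags true xs) _ ⟨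
  (replicate n false ++ blockFlags true xs) ++ blockFlags true ys                 ≡⟨ cong (λ c → _ ++ blockFlags c ys) (BP.∨-zeroʳ b) ⟨
  (replicate n false ++ blockFlags true xs) ++ blockFlags (b ∨ true) ys           ∎)
  where open ≡-Reasoning

blockFlags-[] : ∀ b xs → anyPos xs ≡ false → blockFlags b xs ≡ []
blockFlags-[] b [] _ = refl
blockFlags-[] b (zero ∷ xs) e = blockFlags-[] b xs e

blockFlags-singleton : ∀ b n → blockFlags b (suc n ∷ []) ≡ b ∷ replicate n false
blockFlags-singleton b n = cong (b ∷_) (LP.++-identityʳ (replicate n false))

anyPos-++ : ∀ xs ys → anyPos (xs ++ ys) ≡ anyPos xs ∨ anyPos ys
anyPos-++ [] ys = refl
anyPos-++ (zero ∷ xs) ys = anyPos-++ xs ys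
anyPos-++ (suc _ ∷ xs) ys = refl

anyPos-reverse : ∀ xs → anyPos (reverse xs) ≡ anyPos xs
anyPos-reverse [] = refl
anyPos-reverse (x ∷ xs) = begin
  anyPos (reverse (x ∷ xs))           ≡⟨ cong anyPos (LP.unfold-reverse x xs) ⟩
  anyPos (reverse xs ∷ʳ x)            ≡⟨ anyPos-++ (reverse xs) (x ∷ []) ⟩
  anyPos (reverse xs) ∨ anyPos (x ∷ []) ≡⟨ cong (_∨ anyPos (x ∷ [])) (anyPos-reverse xs) ⟩
  anyPos xs ∨ anyPos (x ∷ [])         ≡⟨ ∨-singleton x ⟩
  anyPos (x ∷ xs)                     ∎
  where
  open ≡-Reasoning
  ∨-singleton : ∀ x → anyPos xs ∨ anyPos (x ∷ []) ≡ anyPos (x ∷ xs)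
  ∨-singleton zero = BP.∨-identityʳ (anyPos xs)
  ∨-singleton (suc _) = BP.∨-zeroʳ (anyPos xs)

labelsFrom-[] : ∀ j α → anyPos α ≡ false → labelsFrom j α ≡ []
labelsFrom-[] j [] _ = refl
labelsFrom-[] j (zero ∷ α) e = labelsFrom-[] (suc j) α e

labelsFrom-∷ : ∀ j α → anyPos α ≡ true → Σ ℕ λ x → Σ (List ℕ) λ xs → (labelsFrom j α ≡ x ∷ xs) × (j ℕ.≤ x)
labelsFrom-∷ j (zero ∷ α) e with labelsFrom-∷ (suc j) α e
... | x , xs , eq , j<x = x , xs , eq , ℕP.<⇒≤ j<x
labelsFrom-∷ j (suc a ∷ α) e = j , labelsFrom j (a ∷ α) , refl , ℕP.≤-refl

replicate-∷ʳ : ∀ {A : Set} n (x : A) → replicate n x ∷ʳ x ≡ x ∷ replicate n x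
replicate-∷ʳ zero x = refl
replicate-∷ʳ (suc n) x = cong (x ∷_) (replicate-∷ʳ n x)

reversedFlags-labelsFrom : ∀ k α → reversedFlags (labelsFrom k α) ≡ blockFlags false (reverse α)
reversedFlags-labelsFrom-∷ : ∀ k a α → reversedFlags (labelsFrom k (a ∷ α)) ≡
                             blockFlags false (reverse α) ++ blockFlags (anyPos (reverse α)) (a ∷ [])

reversedFlags-labelsFrom k [] = refl
reversedFlags-labelsFrom k (a ∷ α) = begin
  reversedFlags (labelsFrom k (a ∷ α))                                      ≡⟨ reversedFlags-labelsFrom-∷ k a α ⟩
  blockFlags false (reverse α) ++ blockFlags (anyPos (reverse α)) (a ∷ [])  ≡⟨ blockFlags-++ false (reverse α) (a ∷ []) ⟨
  blockFlags false (reverse α ∷ʳ a)                                         ≡⟨ cong (blockFlags false) (LP.unfold-reverse a α) ⟨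
  blockFlags false (reverse (a ∷ α))                                        ∎
  where open ≡-Reasoning

reversedFlags-labelsFrom-∷ k zero α = trans (reversedFlags-labelsFrom (suc k) α) (sym (LP.++-identityʳ _))
reversedFlags-labelsFrom-∷ k (suc zero) α with anyPos α in α>0
... | false rewrite labelsFrom-[] (suc k) α α>0 | blockFlags-[] false (reverse α) (trans (anyPos-reverse α) α>0)
                  | anyPos-reverse α | α>0 = refl
... | true with labelsFrom-∷ (suc k) α α>0
...   | x , xs , eq , k<x rewrite eq | anyPos-reverse α | α>0 =
  trans (cong (_∷ʳ ⌊ k ℕ.<? x ⌋) (trans (cong reversedFlags (sym eq)) (reversedFlags-labelsFrom (suc k) α)))
        (cong (blockFlags false (reverse α) ∷ʳ_) (isYes-true (k ℕ.<? x) k<x))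
reversedFlags-labelsFrom-∷ k (suc (suc a)) α = begin
  reversedFlags (labelsFrom k (suc a ∷ α)) ∷ʳ ⌊ k ℕ.<? k ⌋   ≡⟨ cong (reversedFlags (labelsFrom k (suc a ∷ α)) ∷ʳ_) (isYes-false (k ℕ.<? k) (ℕP.<-irrefl refl)) ⟩
  reversedFlags (labelsFrom k (suc a ∷ α)) ∷ʳ false          ≡⟨ cong (_∷ʳ false) (reversedFlags-labelsFrom-∷ k (suc a) α) ⟩
  (B ++ blockFlags b (suc a ∷ [])) ∷ʳ false                  ≡⟨ LP.++-assoc B _ (false ∷ []) ⟩
  B ++ (blockFlags b (suc a ∷ []) ∷ʳ false)                  ≡⟨ cong (λ z → B ++ (z ∷ʳ false)) (blockFlags-singleton b a) ⟩
  B ++ (b ∷ replicate a false ∷ʳ false)                      ≡⟨ cong (λ z → B ++ (b ∷ z)) (replicate-∷ʳ a false) ⟩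
  B ++ (b ∷ false ∷ replicate a false)                       ≡⟨ cong (B ++_) (blockFlags-singleton b (suc a)) ⟨
  B ++ blockFlags b (suc (suc a) ∷ [])                       ∎
  where
  open ≡-Reasoning
  B = blockFlags false (reverse α)
  b = anyPos (reverse α)

strictFlags : Maybe ℤ → List ℤ → List Bool
strictFlags mp [] = []
strictFlags nothing (x ∷ xs) = false ∷ strictFlags (just x) xs
strictFlags (just p) (x ∷ xs) = ⌊ x ℤ.<? p ⌋ ∷ strictFlags (just x) xs

flags-wordPattern : ∀ D → map proj₂ (wordPattern D) ≡ strictFlags nothing D
flags-wordPattern [] = refl
flags-wordPattern (d ∷ ds) = cong (false ∷_) (flags-wordPattern′ d ds)
  where
  flags-wordPattern′ : ∀ p D → map proj₂ (wordPattern′ p D) ≡ strictFlags (just p) D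
  flags-wordPattern′ p [] = refl
  flags-wordPattern′ p (d ∷ ds) = cong (_ ∷_) (flags-wordPattern′ d ds)

strictFlags-replicate : ∀ i n xs → strictFlags (just i) (replicate n i ++ xs) ≡ replicate n false ++ strictFlags (just i) xs
strictFlags-replicate i zero xs = refl
strictFlags-replicate i (suc n) xs = cong₂ _∷_ (isYes-false (i ℤ.<? i) (ℤP.<-irrefl refl)) (strictFlags-replicate i n xs)

Descending : List ℤ → Set
Descending = Linked (λ a b → b ℤ.< a)

strictFlags-concatMap : ∀ (f : ℤ → ℕ) mp R → Descending R → (∀ p → mp ≡ just p → All (ℤ._< p) R) →
                        strictFlags mp (concatMap (λ i → replicate (f i) i) R) ≡ blockFlags (is-just mp) (map f R)
strictFlags-concatMap f mp [] _ _ = refl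
strictFlags-concatMap f mp (i ∷ R) desc R<mp with f i
... | zero = strictFlags-concatMap f mp R (Linked-tail desc) (λ p e → All.tail (R<mp p e))
... | suc n = trans (first mp R<mp) (cong (is-just mp ∷_) (trans (strictFlags-replicate i n _) (cong (replicate n false ++_)
                (strictFlags-concatMap f (just i) R (Linked-tail desc) (λ { p refl → R<i desc })))))
  where
  R<i : ∀ {i R} → Descending (i ∷ R) → All (ℤ._< i) R
  R<i [-] = []
  R<i (r ∷ l) = LinkedP.Linked⇒All (λ p q → ℤP.<-trans q p) r l
  first : ∀ mp → (∀ p → mp ≡ just p → All (ℤ._< p) (i ∷ R)) →
          strictFlags mp (i ∷ (replicate n i ++ concatMap (λ i → replicate (f i) i) R)) ≡
          is-just mp ∷ strictFlags (just i) (replicate n i ++ concatMap (λ i → replicate (f i) i) R)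
  first nothing _ = refl
  first (just p) i<p = cong (_∷ _) (isYes-true (i ℤ.<? p) (All.head (i<p p refl)))

downFrom-Descending : ∀ t k → Descending (downFrom t k)
downFrom-Descending t zero = []
downFrom-Descending t (suc zero) = [-]
downFrom-Descending t (suc (suc k)) = t-1<t ∷ downFrom-Descending (t - + 1) (suc k)
  where
  t-1<t : t - + 1 ℤ.< t
  t-1<t = subst (t - + 1 ℤ.<_) (ℤP.+-identityʳ t) (ℤP.+-monoʳ-< t ℤ.-<+)

positive? : (k : ℕ) → Dec (1 ℕ.≤ k)
positive? k = 1 ℕ.≤? k

blockFlags-filter : ∀ b ns → blockFlags b ns ≡ blockFlags b (filter positive? ns)
blockFlags-filter b [] = refl
blockFlags-filter b (zero ∷ ns) = blockFlags-filter b ns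
blockFlags-filter b (suc n ∷ ns) = cong (λ z → b ∷ (replicate n false ++ z)) (blockFlags-filter true ns)

filter-reverse : ∀ xs → filter positive? (reverse xs) ≡ reverse (filter positive? xs)
filter-reverse [] = refl
filter-reverse (x ∷ xs) = begin
  filter positive? (reverse (x ∷ xs))                           ≡⟨ cong (filter positive?) (LP.unfold-reverse x xs) ⟩
  filter positive? (reverse xs ∷ʳ x)                            ≡⟨ LP.filter-++ positive? (reverse xs) (x ∷ []) ⟩
  filter positive? (reverse xs) ++ filter positive? (x ∷ [])    ≡⟨ cong (_++ filter positive? (x ∷ [])) (filter-reverse xs) ⟩
  reverse (filter positive? xs) ++ filter positive? (x ∷ [])    ≡⟨ ++-singleton x ⟩
  reverse (filter positive? (x ∷ xs))                           ∎
  where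
  open ≡-Reasoning
  ++-singleton : ∀ x → reverse (filter positive? xs) ++ filter positive? (x ∷ []) ≡ reverse (filter positive? (x ∷ xs))
  ++-singleton zero = LP.++-identityʳ _
  ++-singleton (suc n) = sym (LP.unfold-reverse (suc n) (filter positive? xs))

reverse-flat : ∀ v → reverse (flat v) ≡ filter positive? (map (c v) (range v))
reverse-flat v = begin
  reverse (filter positive? (map (c v) (reverse (range v))))  ≡⟨ cong (reverse ∘ filter positive?) (LP.reverse-map (c v) (range v)) ⟩
  reverse (filter positive? (reverse (map (c v) (range v))))  ≡⟨ cong reverse (filter-reverse (map (c v) (range v))) ⟩
  reverse (reverse (filter positive? (map (c v) (range v))))  ≡⟨ LP.reverse-involutive _ ⟩
  filter positive? (map (c v) (range v))                      ∎
  where open ≡-Reasoning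

flags-word : ∀ v → map proj₂ (wordPattern (word v)) ≡ reversedFlags (labelsFrom 1 (flat v))
flags-word v = begin
  map proj₂ (wordPattern (word v))                           ≡⟨ flags-wordPattern (word v) ⟩
  strictFlags nothing (word v)                               ≡⟨ strictFlags-concatMap (c v) nothing (range v) (downFrom-Descending _ _) (λ _ ()) ⟩
  blockFlags false (map (c v) (range v))                     ≡⟨ blockFlags-filter false (map (c v) (range v)) ⟩
  blockFlags false (filter positive? (map (c v) (range v)))  ≡⟨ cong (blockFlags false) (reverse-flat v) ⟨
  blockFlags false (reverse (flat v))                        ≡⟨ reversedFlags-labelsFrom 1 (flat v) ⟨
  reversedFlags (labelsFrom 1 (flat v))                      ∎
  where open ≡-Reasoning

QF-flat : ∀ v m → QF (flat v) m ≡ series (constPattern (+ 0) (map proj₂ (wordPattern (word v)))) m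
QF-flat v m = cong indicator (begin
  qcheck (labelsFrom 1 (flat v)) (reverse m)                                           ≡⟨ qcheck≡accepts-reverse (labelsFrom 1 (flat v)) (reverse m) ⟩
  accepts (constPattern (+ 0) (reversedFlags (labelsFrom 1 (flat v)))) (reverse (reverse m)) ≡⟨ cong₂ accepts (cong (constPattern (+ 0)) (flags-word v)) (sym (LP.reverse-involutive m)) ⟨
  accepts (constPattern (+ 0) (map proj₂ (wordPattern (word v)))) m                    ∎)
  where open ≡-Reasoning


shift : ℕ → ℤ → ℤ
shift K x = x - + K

shift-< : ∀ K {x y} → x ℤ.< y → shift K x ℤ.< shift K y
shift-< K = ℤP.+-monoˡ-< (ℤ.- (+ K))

shift-≤ : ∀ K {x y} → x ℤ.≤ y → shift K x ℤ.≤ shift K y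
shift-≤ K = ℤP.+-monoˡ-≤ (ℤ.- (+ K))

shift-nonpositive : ∀ K {x} → x ℤ.≤ + 0 → shift K x ℤ.≤ + 0
shift-nonpositive K = ℤP.i≤j⇒i-k≤j (+ K)

shift-≤-K : ∀ K {x} → x ℤ.≤ + 0 → shift K x ℤ.≤ ℤ.- (+ K)
shift-≤-K K {x} x≤0 = subst (shift K x ℤ.≤_) (ℤP.+-identityˡ (ℤ.- (+ K))) (ℤP.+-monoˡ-≤ (ℤ.- (+ K)) x≤0)

Shifted : ℕ → ℤ → ℤ → Set
Shifted K x y = (y ≡ shift K x) × (x ℤ.≤ + 0)

Shifted-SameOrder : ∀ K {x x' y y'} → Shifted K x x' → Shifted K y y' → SameOrder x x' y y'
Shifted-SameOrder K {x} {_} {y} (refl , _) (refl , _) with compare x y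
... | tri< x<y _ _ = inj₂ (inj₁ (x<y , shift-< K x<y))
... | tri≈ _ refl _ = inj₁ (refl , refl)
... | tri> _ _ y<x = inj₂ (inj₂ (y<x , shift-< K y<x))

Shifted-nonpositive : ∀ K {x x'} → Shifted K x x' → (x ℤ.≤ + 0) × (x' ℤ.≤ + 0)
Shifted-nonpositive K (refl , x≤0) = x≤0 , shift-nonpositive K x≤0

Shifted-map : ∀ K m → All (ℤ._≤ + 0) m → Pointwise (Shifted K) m (map (shift K) m)
Shifted-map K [] [] = []
Shifted-map K (x ∷ m) (x≤0 ∷ m≤0) = (refl , x≤0) ∷ Shifted-map K m m≤0

push : ℤ → List (ℤ × ℕ) → List (ℤ × ℕ)
push x [] = (x , 1) ∷ []
push x ((y , n) ∷ ds) with x ℤ.≟ y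
... | yes _ = (y , suc n) ∷ ds
... | no _ = (x , 1) ∷ (y , n) ∷ ds

runs : List ℤ → List (ℤ × ℕ)
runs [] = []
runs (x ∷ m) = push x (runs m)

block : ℤ × ℕ → List ℤ
block (x , n) = replicate n x

concat-runs : ∀ m → concat (map block (runs m)) ≡ m
concat-runs [] = refl
concat-runs (x ∷ m) = trans (concat-push x (runs m)) (cong (x ∷_) (concat-runs m))
  where
  concat-push : ∀ x ds → concat (map block (push x ds)) ≡ x ∷ concat (map block ds)
  concat-push x [] = refl
  concat-push x ((y , n) ∷ ds) with x ℤ.≟ y
  ... | yes refl = refl
  ... | no _ = refl

runs-All : ∀ (P : ℤ → Set) m → All P m → All (P ∘ proj₁) (runs m)
runs-All P [] [] = []
runs-All P (x ∷ m) (px ∷ pm) = push-All x (runs m) px (runs-All P m pm)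
  where
  push-All : ∀ x ds → P x → All (P ∘ proj₁) ds → All (P ∘ proj₁) (push x ds)
  push-All x [] px [] = px ∷ []
  push-All x ((y , n) ∷ ds) px (py ∷ pds) with x ℤ.≟ y
  ... | yes _ = py ∷ pds
  ... | no _ = px ∷ py ∷ pds

runs-positive : ∀ m → All (λ d → 0 ℕ.< proj₂ d) (runs m)
runs-positive [] = []
runs-positive (x ∷ m) = push-positive x (runs m) (runs-positive m)
  where
  push-positive : ∀ x ds → All (λ d → 0 ℕ.< proj₂ d) ds → All (λ d → 0 ℕ.< proj₂ d) (push x ds)
  push-positive x [] [] = ℕ.s≤s ℕ.z≤n ∷ []
  push-positive x ((y , n) ∷ ds) (p ∷ ps) with x ℤ.≟ y
  ... | yes _ = ℕ.s≤s ℕ.z≤n ∷ ps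
  ... | no _ = ℕ.s≤s ℕ.z≤n ∷ p ∷ ps

DescendingRuns : List (ℤ × ℕ) → Set
DescendingRuns = Linked (λ a b → proj₁ b ℤ.< proj₁ a)

runs-Descending : ∀ m → Mono m → DescendingRuns (runs m)
runs-Descending [] _ = []
runs-Descending (x ∷ m) mo = push-Descending x (runs m) (runs-All (ℤ._≤ x) m (Mono⇒≤head mo)) (runs-Descending m (Mono-tail mo))
  where
  push-Descending : ∀ x ds → All ((ℤ._≤ x) ∘ proj₁) ds → DescendingRuns ds → DescendingRuns (push x ds)
  push-Descending x [] _ _ = [-]
  push-Descending x ((y , n) ∷ ds) (y≤x ∷ _) desc with x ℤ.≟ y
  ... | yes _ = grow desc
    where
    grow : ∀ {ds} → DescendingRuns ((y , n) ∷ ds) → DescendingRuns ((y , suc n) ∷ ds)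
    grow [-] = [-]
    grow (r ∷ l) = r ∷ l
  ... | no x≢y = ℤP.≤∧≢⇒< y≤x (x≢y ∘ sym) ∷ desc

Linked-reverse : ∀ {R : ℤ → ℤ → Set} xs → Linked R xs → Linked (flip R) (reverse xs)
Linked-reverse {R} [] _ = []
Linked-reverse {R} (x ∷ xs) l = go x [] xs [-] l
  where
  go : ∀ a acc xs → Linked (flip R) (a ∷ acc) → Linked R (a ∷ xs) → Linked (flip R) (foldl (flip _∷_) (a ∷ acc) xs)
  go a acc [] la _ = la
  go a acc (y ∷ ys) la (r ∷ ly) = go y (a ∷ acc) ys (r ∷ la) ly

All-reverse : ∀ {A : Set} {P : A → Set} xs → All P xs → All P (reverse xs)
All-reverse {A} {P} xs pxs = go [] xs [] pxs
  where
  go : ∀ acc xs → All P acc → All P xs → All P (foldl (flip _∷_) acc xs)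
  go acc [] pacc _ = pacc
  go acc (y ∷ ys) pacc (py ∷ pys) = go (y ∷ acc) ys (py ∷ pacc) pys

reverse-replicate : ∀ {A : Set} n (x : A) → reverse (replicate n x) ≡ replicate n x
reverse-replicate zero x = refl
reverse-replicate (suc n) x = begin
  reverse (x ∷ replicate n x)     ≡⟨ LP.unfold-reverse x (replicate n x) ⟩
  reverse (replicate n x) ∷ʳ x    ≡⟨ cong (_∷ʳ x) (reverse-replicate n x) ⟩
  replicate n x ∷ʳ x              ≡⟨ replicate-∷ʳ n x ⟩
  x ∷ replicate n x               ∎
  where open ≡-Reasoning

reverse-concat-reverse : ∀ {A : Set} (xss : List (List A)) → reverse (concat (reverse xss)) ≡ concat (map reverse xss)
reverse-concat-reverse [] = refl
reverse-concat-reverse (X ∷ xss) = begin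
  reverse (concat (reverse (X ∷ xss)))                 ≡⟨ cong (reverse ∘ concat) (LP.unfold-reverse X xss) ⟩
  reverse (concat (reverse xss ∷ʳ X))                  ≡⟨ cong reverse (LP.concat-++ (reverse xss) (X ∷ [])) ⟨
  reverse (concat (reverse xss) ++ (X ++ []))          ≡⟨ LP.reverse-++ (concat (reverse xss)) (X ++ []) ⟩
  reverse (X ++ []) ++ reverse (concat (reverse xss))  ≡⟨ cong₂ _++_ (cong reverse (LP.++-identityʳ X)) (reverse-concat-reverse xss) ⟩
  reverse X ++ concat (map reverse xss)                ∎
  where open ≡-Reasoning

reverse-blocks : ∀ ds → reverse (blocks (reverse (map proj₁ ds)) (reverse (map proj₂ ds))) ≡ concat (map block ds)
reverse-blocks ds = begin
  reverse (blocks (reverse (map proj₁ ds)) (reverse (map proj₂ ds)))  ≡⟨ cong₂ (λ is a → reverse (blocks is a)) (LP.reverse-map proj₁ ds) (LP.reverse-map proj₂ ds) ⟨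
  reverse (blocks (map proj₁ (reverse ds)) (map proj₂ (reverse ds)))  ≡⟨ cong (reverse ∘ concat) (zipWith-runs (reverse ds)) ⟩
  reverse (concat (map block (reverse ds)))                           ≡⟨ cong (reverse ∘ concat) (LP.reverse-map block ds) ⟩
  reverse (concat (reverse (map block ds)))                           ≡⟨ reverse-concat-reverse (map block ds) ⟩
  concat (map reverse (map block ds))                                 ≡⟨ cong concat (map-reverse-block ds) ⟩
  concat (map block ds)                                               ∎
  where
  open ≡-Reasoning
  zipWith-runs : ∀ ds → zipWith (λ i k → replicate k i) (map proj₁ ds) (map proj₂ ds) ≡ map block ds
  zipWith-runs [] = refl
  zipWith-runs ((x , n) ∷ ds) = cong (replicate n x ∷_) (zipWith-runs ds)
  map-reverse-block : ∀ ds → map reverse (map block ds) ≡ map block ds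
  map-reverse-block [] = refl
  map-reverse-block ((x , n) ∷ ds) = cong₂ _∷_ (reverse-replicate n x) (map-reverse-block ds)

blocks-shift : ∀ K is a → blocks (map (shift K) is) a ≡ map (shift K) (blocks is a)
blocks-shift K is a = trans (cong concat (zipWith-shift is a)) (LP.concat-map {f = shift K} (zipWith (λ i k → replicate k i) is a))
  where
  zipWith-shift : ∀ is a → zipWith (λ i k → replicate k i) (map (shift K) is) a ≡ map (map (shift K)) (zipWith (λ i k → replicate k i) is a)
  zipWith-shift [] a = refl
  zipWith-shift (i ∷ is) [] = refl
  zipWith-shift (i ∷ is) (k ∷ a) = cong₂ _∷_ (sym (LP.map-replicate (shift K) k i)) (zipWith-shift is a)

-- Writing m as x_{i₁}^{a₁} ⋯ x_{i_k}^{a_k} with i₁ < ⋯ < i_k ≤ 0, shifting is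
-- a change of the indices i_j preserving their order.
QSymMinus-shift : ∀ {g} → QSymMinus g → ∀ K m → Mono m → All (ℤ._≤ + 0) m → g m ≡ g (map (shift K) m)
QSymMinus-shift {g} q K m mo m≤0 = begin
  g m                          ≡⟨ cong g m≡blocks ⟨
  g (reverse (blocks is a))    ≡⟨ QSymMinus.quasisym q a is js a>0 is< js< is≤0 js≤0 is≡a js≡a ⟩
  g (reverse (blocks js a))    ≡⟨ cong g shifted≡blocks ⟩
  g (map (shift K) m)          ∎
  where
  open ≡-Reasoning
  ds = runs m
  is = reverse (map proj₁ ds)
  a = reverse (map proj₂ ds)
  js = map (shift K) is
  m≡blocks : reverse (blocks is a) ≡ m
  m≡blocks = trans (reverse-blocks ds) (concat-runs m)
  shifted≡blocks : reverse (blocks js a) ≡ map (shift K) m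
  shifted≡blocks = begin
    reverse (blocks js a)                ≡⟨ cong reverse (blocks-shift K is a) ⟩
    reverse (map (shift K) (blocks is a)) ≡⟨ LP.reverse-map (shift K) (blocks is a) ⟨
    map (shift K) (reverse (blocks is a)) ≡⟨ cong (map (shift K)) m≡blocks ⟩
    map (shift K) m                      ∎
  a>0 : All (0 ℕ.<_) a
  a>0 = All-reverse (map proj₂ ds) (AllP.map⁺ (runs-positive m))
  is< : Linked ℤ._<_ is
  is< = Linked-reverse (map proj₁ ds) (LinkedP.map⁺ (runs-Descending m mo))
  js< : Linked ℤ._<_ js
  js< = LinkedP.map⁺ (Lk.map (shift-< K) is<)
  is≤0 : All (ℤ._≤ + 0) is
  is≤0 = All-reverse (map proj₁ ds) (AllP.map⁺ (runs-All (ℤ._≤ + 0) m m≤0))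
  js≤0 : All (ℤ._≤ + 0) js
  js≤0 = AllP.map⁺ (All.map (shift-nonpositive K) is≤0)
  is≡a : length is ≡ length a
  is≡a = begin
    length (reverse (map proj₁ ds))  ≡⟨ LP.length-reverse (map proj₁ ds) ⟩
    length (map proj₁ ds)            ≡⟨ LP.length-map proj₁ ds ⟩
    length ds                        ≡⟨ LP.length-map proj₂ ds ⟨
    length (map proj₂ ds)            ≡⟨ LP.length-reverse (map proj₂ ds) ⟨
    length (reverse (map proj₂ ds))  ∎
  js≡a : length js ≡ length a
  js≡a = trans (LP.length-map (shift K) is) is≡a

-- Uniqueness of the constant term

accepts-capsIrrelevant : ∀ B P m → All (ℤ._≤ B) m → All (B ℤ.≤_) (caps P) → B ℤ.≤ + 0 →
                         accepts P m ≡ accepts (constPattern (+ 0) (map proj₂ P)) m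
accepts-capsIrrelevant B [] [] _ _ _ = refl
accepts-capsIrrelevant B [] (_ ∷ _) _ _ _ = refl
accepts-capsIrrelevant B (_ ∷ _) [] _ _ _ = refl
accepts-capsIrrelevant B ((d , f) ∷ []) (i ∷ []) (i≤B ∷ _) (B≤d ∷ _) B≤0 =
  trans (isYes-true (i ℤ.≤? d) (ℤP.≤-trans i≤B B≤d)) (sym (isYes-true (i ℤ.≤? + 0) (ℤP.≤-trans i≤B B≤0)))
accepts-capsIrrelevant B ((d , f) ∷ []) (i ∷ _ ∷ _) _ _ _ = refl
accepts-capsIrrelevant B ((d , f) ∷ _ ∷ _) (i ∷ []) _ _ _ = refl
accepts-capsIrrelevant B ((d , f) ∷ (d' , f') ∷ P) (i ∷ i' ∷ m) (i≤B ∷ m≤B) (B≤d ∷ B≤P) B≤0 =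
  cong₂ _∧_ (trans (isYes-true (i ℤ.≤? d) (ℤP.≤-trans i≤B B≤d)) (sym (isYes-true (i ℤ.≤? + 0) (ℤP.≤-trans i≤B B≤0))))
    (cong (λ x → ⌊ i' ℤ.≤? i ⌋ ∧ (if f' then ⌊ i' ℤ.<? i ⌋ else true) ∧ x)
      (accepts-capsIrrelevant B ((d' , f') ∷ P) (i' ∷ m) m≤B B≤P B≤0))

comp₀-positive : ∀ d → All ValidTerm d → ∀ m → Mono m → Any (+ 0 ℤ.<_) m → comp₀ d m ≡ 0ℚ
comp₀-positive [] [] m mo m>0 = refl
comp₀-positive (([] , g) ∷ d) ((_ , q) ∷ vd) m mo m>0 =
  trans (cong₂ ℚ._+_ (QSymMinus.onlyMinus q m mo m>0) (comp₀-positive d vd m mo m>0)) 0+0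
comp₀-positive ((_ ∷ _ , g) ∷ d) (_ ∷ vd) m mo m>0 = trans (cong (0ℚ ℚ.+_) (comp₀-positive d vd m mo m>0)) 0+0

QF-positive : ∀ α m → Any (+ 0 ℤ.<_) m → QF α m ≡ 0ℚ
QF-positive α m m>0 with qcheck (labelsFrom 1 α) (reverse m) in accepted
... | false = refl
... | true = ⊥-elim (All≤0⇒¬Any>0 (qcheck⇒nonpositive (labelsFrom 1 α) (reverse m) accepted) (AnyP.reverse⁺ m>0))

comp₀-shift : ∀ K m → Mono m → All (ℤ._≤ + 0) m → ∀ d → All ValidTerm d → comp₀ d m ≡ comp₀ d (map (shift K) m)
comp₀-shift K m mo m≤0 [] [] = refl
comp₀-shift K m mo m≤0 (([] , g) ∷ d) ((_ , q) ∷ vd) = cong₂ ℚ._+_ (QSymMinus-shift q K m mo m≤0) (comp₀-shift K m mo m≤0 d vd)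
comp₀-shift K m mo m≤0 ((_ ∷ _ , g) ∷ d) (_ ∷ vd) = cong (0ℚ ℚ.+_) (comp₀-shift K m mo m≤0 d vd)

headAbs : List ℤ → ℕ
headAbs [] = 0
headAbs (b ∷ _) = ∣ b ∣

-K< : ∀ K b → ∣ b ∣ ℕ.< K → ℤ.- (+ K) ℤ.< b
-K< (suc K) (+ n) _ = ℤ.-<+
-K< (suc K) -[1+ n ] (ℕ.s≤s lt) = ℤ.-<- lt

-- No nonconstant key divides a monomial lying entirely left of all keys.
comp₀≡eval-far : ∀ K m → All (ℤ._≤ ℤ.- (+ K)) m → ∀ d → All (λ p → headAbs (proj₁ p) ℕ.< K) d → comp₀ d m ≡ evalDecomp d m
comp₀≡eval-far K m m≤-K [] [] = refl
comp₀≡eval-far K m m≤-K (([] , g) ∷ d) (_ ∷ d<K) = cong₂ ℚ._+_ (sym (timesMono≡maybe g [] m)) (comp₀≡eval-far K m m≤-K d d<K)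
comp₀≡eval-far K m m≤-K ((b ∷ e , g) ∷ d) (∣b∣<K ∷ d<K) =
  cong₂ ℚ._+_ (sym (trans (timesMono≡maybe g (b ∷ e) m) (cong (maybe′ g 0ℚ) (divide-below m e (-K< K b ∣b∣<K) m≤-K))))
              (comp₀≡eval-far K m m≤-K d d<K)

η₀-unique : ∀ v d → ValidDecomp d → evalDecomp d ≈ Fback v → comp₀ d ≈ QF (flat v)
η₀-unique v d (vd , _) d≈F m mo with All.all? (ℤ._≤? + 0) m
... | no m≰0 = trans (comp₀-positive d vd m mo m>0) (sym (QF-positive (flat v) m m>0))
  where
  m>0 : Any (+ 0 ℤ.<_) m
  m>0 = Any.map ℤP.≰⇒> (AllPC.¬All⇒Any¬ (ℤ._≤? + 0) m m≰0)
... | yes m≤0 = begin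
  comp₀ d m                     ≡⟨ comp₀-shift K m mo m≤0 d vd ⟩
  comp₀ d m′                    ≡⟨ comp₀≡eval-far K m′ m′≤-K d keys<K ⟩
  evalDecomp d m′               ≡⟨ d≈F m′ (LinkedP.map⁺ (Lk.map (shift-≤ K) mo)) ⟩
  Fback v m′                    ≡⟨ cong indicator (fcheck≡accepts (word v) m′) ⟩
  series P m′                   ≡⟨ cong indicator (accepts-capsIrrelevant (ℤ.- (+ K)) P m′ m′≤-K -K≤caps ℤP.neg-≤-pos) ⟩
  series (constPattern (+ 0) flags) m′  ≡⟨ cong indicator (Shifts.accepts-constPattern0-resp flags (Shifted-map K m m≤0)) ⟨
  series (constPattern (+ 0) flags) m   ≡⟨ QF-flat v m ⟨
  QF (flat v) m                 ∎
  where
  open ≡-Reasoning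
  P = wordPattern (word v)
  flags = map proj₂ P
  keySum = sum (map (headAbs ∘ proj₁) d)
  capSum = sum (map ∣_∣ (caps P))
  K = suc (keySum ℕ.+ capSum)
  m′ = map (shift K) m
  module Shifts = OrderInvariance (Shifted K) (Shifted-SameOrder K) (Shifted-nonpositive K)
  m′≤-K : All (ℤ._≤ ℤ.- (+ K)) m′
  m′≤-K = AllP.map⁺ (All.map (shift-≤-K K) m≤0)
  keys<K : All (λ p → headAbs (proj₁ p) ℕ.< K) d
  keys<K = AllP.map⁻ (All.map (λ le → ℕ.s≤s (ℕP.≤-trans le (ℕP.m≤m+n keySum capSum))) (≤sum (map (headAbs ∘ proj₁) d)))
  -K≤caps : All (ℤ.- (+ K) ℤ.≤_) (caps P)
  -K≤caps = All.map (λ {d} ∣d∣≤S → ℤP.≤-trans (ℤP.neg-mono-≤ (ℤ.+≤+ S≤K)) (proj₁ (∣∣≤⇒Between capSum d ∣d∣≤S))) (AllP.map⁻ (≤sum (map ∣_∣ (caps P))))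
    where
    S≤K : capSum ℕ.≤ K
    S≤K = ℕP.≤-trans (ℕP.m≤n+m capSum keySum) (ℕP.n≤1+n _)

lemma4p11 : (v : NVec) →
    Eta₀Is (Fback v) (QF (flat v))
    × (SuppPos v → π₊ (Fback v) ≈ Fslide v)
    × (¬ SuppPos v → π₊ (Fback v) ≈ zeroS)
lemma4p11 v = (Decomposable⇒valid (Fback-decomposable v) , η₀-unique v) , π₊-Fback-SuppPos v , π₊-Fback-¬SuppPos v
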